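{- Let $\lambda \vdash n$ with $\ell(\lambda) = n-k$, and fix an integer $d$. Then \[ \sum_{\substack{\Lambda \in P[n] :\ \Pi(\lambda) \leq \Lambda \\ \#\Lambda = n-d}} \mu(\Pi(\lambda), \Lambda) = (-1)^{d-k} \sum_{\substack{\Lambda \in P[n-k] \\ \#\Lambda = n-d}} \prod_{A \in \Lambda} (\#A - 1)!, \] and the terms of the sum on the left all have the same sign $(-1)^{d-k}$. The sums are empty unless $n \geq d \geq k \geq 0$.
   Context: $P[n]$ denotes the lattice of set partitions of $[n] = \{1,\dots,n\}$, ordered by $\Lambda \le \Pi$ iff $\Pi$ is obtained from $\Lambda$ by merging blocks of $\Lambda$; $\mu(\cdot,\cdot)$ is the Möbius function of this lattice. $\#\Lambda$ denotes the number of blocks of a set partition $\Lambda$, and $\#A$ the size of a block $A$. For an integer partition $\lambda = (\lambda_1 \ge \lambda_2 \ge \cdots) \vdash n$ with $\ell(\lambda)$ parts, $\Pi(\lambda)$ is the set partition $\{\{1,\dots,\lambda_1\}, \{\lambda_1+1,\dots,\lambda_1+\lambda_2\}, \dots\}$ of $[n]$ into consecutive blocks of sizes $\lambda_1, \lambda_2, \ldots$. -}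

module Defs where

import Data.Bool
import Data.Integer
open import Data.Bool using (Bool; true; false; if_then_else_; _∧_; _∨_; not)
open import Data.Nat using (ℕ; zero; suc; _≡ᵇ_; _∸_) renaming (_+_ to _+ℕ_)
open import Data.Nat using (_!)
open import Data.Bool.ListAction using (all)
open import Relation.Nullary.Decidable using (T?)
open import Data.Integer using (ℤ; +_; -_; _+_; _*_)
open import Data.List using (List; []; _∷_; _++_; map; concatMap; upTo; filter;
  length; replicate; foldr; deduplicate; zip; cartesianProduct)
open import Data.List.Properties using (≡-dec)
open import Data.Nat.Properties using (_≟_)
open import Data.Product using (_×_; _,_)
open import Relation.Nullary.Decidable using (⌊_⌋; does)

-- Set partitions of [n] = {1,…,n} are represented canonically by their
-- restricted growth strings: a list a of length n, a_i = index (0-based, in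
-- order of first appearance) of the block containing element i+1.
-- Two elements lie in the same block iff they carry the same label.

-- gen r m : all restricted-growth continuations of length r when m labels
-- {0,…,m-1} have already been used.
gen : ℕ → ℕ → List (List ℕ)
gen zero    m = [] ∷ []
gen (suc r) m = concatMap (λ b → map (b ∷_) (gen r (if b ≡ᵇ m then suc m else m))) (upTo (suc m))

P : ℕ → List (List ℕ)
P n = gen n 0

labels : List ℕ → List ℕ
labels x = deduplicate _≟_ x

nblocks : List ℕ → ℕ
nblocks x = length (labels x)

blockSizes : List ℕ → List ℕ
blockSizes x = map (λ b → length (filter (λ a → b ≟ a) x)) (labels x)

-- Refinement order: Λ ≤ Π iff every block of Λ is contained in a block of Π,
-- i.e. elements in the same block of Λ are in the same block of Π.
_≤ᵇ_ : List ℕ → List ℕ → Bool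
x ≤ᵇ y = all (λ { ((xi , yi) , (xj , yj)) → not (xi ≡ᵇ xj) ∨ (yi ≡ᵇ yj) })
             (cartesianProduct (zip x y) (zip x y))

_==_ : List ℕ → List ℕ → Bool
x == y = does (≡-dec _≟_ x y)

sumℤ : List ℤ → ℤ
sumℤ = foldr _+_ (+ 0)

productℤ : List ℤ → ℤ
productℤ = foldr _*_ (+ 1)

-- The recursion is unfolded with a fuel parameter; fuel (suc n) is more than
-- the length of any chain in P[n], so the fuel never runs out.
μ-fuel : ℕ → List (List ℕ) → List ℕ → List ℕ → ℤ
μ-fuel zero    U x y = + 0
μ-fuel (suc f) U x y =
  if x == y then + 1
  else if x ≤ᵇ y then - sumℤ (map (μ-fuel f U x) (filter (λ z → T? ((x ≤ᵇ z) ∧ ((z ≤ᵇ y) ∧ not (z == y)))) U))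
  else + 0

μ : (n : ℕ) → List ℕ → List ℕ → ℤ
μ n = μ-fuel (suc n) (P n)

Πgo : ℕ → List ℕ → List ℕ
Πgo i []       = []
Πgo i (p ∷ ps) = replicate p i ++ Πgo (suc i) ps

Π : List ℕ → List ℕ
Π λ' = Πgo 0 λ'

lhsIndex : ℕ → List ℕ → ℤ → List (List ℕ)
lhsIndex n λ' d = filter (λ Λ → T? (Π λ' ≤ᵇ Λ))
                         (filter (λ Λ → Data.Integer._≟_ (+ nblocks Λ) (+ n Data.Integer.- d)) (P n))

rhsIndex : ℕ → ℕ → ℤ → List (List ℕ)
rhsIndex m n d = filter (λ Λ → Data.Integer._≟_ (+ nblocks Λ) (+ n Data.Integer.- d)) (P m)

blockWeight : List ℕ → ℤ
blockWeight Λ = productℤ (map (λ s → + ((s ∸ 1) !)) (blockSizes Λ))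

-- Merging blocks of Π(λ) identifies the interval [Π(λ), 1̂] of P[n] with P[ℓ(λ)] = P[n-k], so the left
-- side is a sum of μ(0̂, σ) over the σ ∈ P[n-k] with n-d blocks. The classical value
-- μ(0̂, σ) = ∏_{A ∈ σ} (-1)^{#A-1} (#A-1)! = (-1)^{(n-k)-#σ} ∏_{A ∈ σ} (#A-1)! (here μ₀) then gives the
-- identity, the common sign and the range of d. That μ₀ satisfies the Möbius recursion is a product formula:
-- in Σ_{z ≤ σ} μ₀ z, choosing the block of z for each element in turn, an element contributes the factor
-- 1 - (number of earlier elements of its σ-block), so the sum vanishes unless σ = 0̂.

module Submission where

open import Defs
open import Data.Nat using (ℕ; _∸_) renaming (_<_ to _<ℕ_; _≥_ to _≥ℕ_; _+_ to _+ℕ_)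
open import Data.Integer using (ℤ; +_; -_; _-_; _*_; _^_; ∣_∣; _<_; _≤_)
open import Data.List using (List; []; length; map)
open import Data.Nat.ListAction using (sum)
open import Data.List.Relation.Unary.All using (All)
open import Data.List.Relation.Unary.Linked using (Linked)
open import Data.Product using (_×_)
open import Relation.Nullary using (¬_)
open import Relation.Binary.PropositionalEquality using (_≡_)

open import Data.Bool using (Bool; true; false; T; _∧_; _∨_; not; if_then_else_)
open import Data.Bool.Properties using (T-≡)
open import Data.Empty using (⊥-elim)
open import Data.Integer using () renaming (_+_ to _+ᶻ_)
import Data.Integer as Z
import Data.Integer.Properties as ZP
open import Data.Integer.Tactic.RingSolver using (solve-∀)
open import Data.List using (_∷_; _++_; _ʳ++_; filter; concat; concatMap; upTo; zip; replicate; cartesianProduct)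
import Data.List.Properties as LP
open import Data.List.Membership.Propositional using (_∈_; find)
import Data.List.Membership.Propositional.Properties as MP
open import Data.List.Relation.Binary.Subset.Propositional using (_⊆_)
open import Data.List.Relation.Unary.All using ([]; _∷_; tabulate; lookup)
import Data.List.Relation.Unary.All.Properties as AllP
open import Data.List.Relation.Unary.Any using (here; there)
open import Data.List.Relation.Unary.AllPairs using ([]; _∷_)
open import Data.List.Relation.Unary.Unique.Propositional using (Unique)
open import Data.Nat using (zero; suc; _≡ᵇ_; z≤n; s≤s; _!) renaming (_≤_ to _≤ℕ_)
import Data.Nat as N
import Data.Nat.Properties as NP
open import Data.Nat.Properties using (_!≢0)
open import Data.Nat.ListAction using (product)
open import Data.Nat.ListAction.Properties using (product≢0)
open import Data.List.Membership.DecPropositional NP._≟_ using (_∈?_)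
open import Data.List.Relation.Unary.Unique.DecPropositional.Properties NP._≟_ using (deduplicate-!)
open import Data.Product using (_,_; proj₁; proj₂; ∃)
open import Data.Sum using (inj₁; inj₂)
open import Data.Unit using (tt)
open import Function using (_∘_; mk⇔; Equivalence)
open import Relation.Nullary using (yes; no; does; ¬?)
open import Relation.Nullary.Decidable using (T?; dec-true; dec-false; does-⇔)
open import Relation.Unary using (Decidable)
open import Relation.Binary.PropositionalEquality
  using (_≢_; refl; sym; trans; cong; cong₂; subst; subst₂; module ≡-Reasoning)

module _ {a} {A : Set a} where

  filter-cong-∈ : ∀ {p q} {P : A → Set p} {Q : A → Set q} (P? : Decidable P) (Q? : Decidable Q)
    (xs : List A) → (∀ x → x ∈ xs → does (P? x) ≡ does (Q? x)) → filter P? xs ≡ filter Q? xs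
  filter-cong-∈ P? Q? [] h = refl
  filter-cong-∈ P? Q? (x ∷ xs) h with does (P? x) | does (Q? x) | h x (here refl)
  ... | true  | true  | _ = cong (x ∷_) (filter-cong-∈ P? Q? xs (λ y m → h y (there m)))
  ... | false | false | _ = filter-cong-∈ P? Q? xs (λ y m → h y (there m))

  filter-none-∈ : ∀ {p} {P : A → Set p} (P? : Decidable P) (xs : List A) →
    (∀ x → x ∈ xs → does (P? x) ≡ false) → filter P? xs ≡ []
  filter-none-∈ P? [] h = refl
  filter-none-∈ P? (x ∷ xs) h with does (P? x) | h x (here refl)
  ... | false | _ = filter-none-∈ P? xs (λ y m → h y (there m))

  filter-all-∈ : ∀ {p} {P : A → Set p} (P? : Decidable P) (xs : List A) →
    (∀ x → x ∈ xs → does (P? x) ≡ true) → filter P? xs ≡ xs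
  filter-all-∈ P? [] h = refl
  filter-all-∈ P? (x ∷ xs) h with does (P? x) | h x (here refl)
  ... | true | _ = cong (x ∷_) (filter-all-∈ P? xs (λ y m → h y (there m)))

  filter-∧ : ∀ (p q : A → Bool) (xs : List A) →
    filter (λ x → T? (p x ∧ q x)) xs ≡ filter (λ x → T? (q x)) (filter (λ x → T? (p x)) xs)
  filter-∧ p q [] = refl
  filter-∧ p q (x ∷ xs) with p x
  ... | false = filter-∧ p q xs
  ... | true with q x
  ... | true  = cong (x ∷_) (filter-∧ p q xs)
  ... | false = filter-∧ p q xs

  filter-comm : ∀ {p q} {P : A → Set p} {Q : A → Set q} (P? : Decidable P) (Q? : Decidable Q)
    (xs : List A) → filter P? (filter Q? xs) ≡ filter Q? (filter P? xs)
  filter-comm P? Q? [] = refl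
  filter-comm P? Q? (x ∷ xs) with does (Q? x) in q | does (P? x) in p
  ... | true  | true  rewrite q | p = cong (x ∷_) (filter-comm P? Q? xs)
  ... | true  | false rewrite p = filter-comm P? Q? xs
  ... | false | true  rewrite q = filter-comm P? Q? xs
  ... | false | false = filter-comm P? Q? xs

  filter-concatMap : ∀ {b p} {B : Set b} {P : A → Set p} (P? : Decidable P) (F : B → List A) (xs : List B) →
    filter P? (concatMap F xs) ≡ concatMap (filter P? ∘ F) xs
  filter-concatMap P? F [] = refl
  filter-concatMap P? F (x ∷ xs) =
    trans (LP.filter-++ P? (F x) (concatMap F xs)) (cong (filter P? (F x) ++_) (filter-concatMap P? F xs))

  filter-map : ∀ {b p} {B : Set b} {P : A → Set p} (P? : Decidable P) (f : B → A) (xs : List B) →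
    filter P? (map f xs) ≡ map f (filter (P? ∘ f) xs)
  filter-map P? f [] = refl
  filter-map P? f (x ∷ xs) with does (P? (f x))
  ... | true  = cong (f x ∷_) (filter-map P? f xs)
  ... | false = filter-map P? f xs

  concatMap-≡[] : ∀ {b} {B : Set b} (F : B → List A) (xs : List B) →
    (∀ x → x ∈ xs → F x ≡ []) → concatMap F xs ≡ []
  concatMap-≡[] F [] h = refl
  concatMap-≡[] F (x ∷ xs) h rewrite h x (here refl) = concatMap-≡[] F xs (λ y m → h y (there m))

upTo-suc : ∀ k → upTo (suc k) ≡ 0 ∷ map suc (upTo k)
upTo-suc k = cong (0 ∷_) (sym (LP.map-upTo suc k))

concatMap-upTo-single : ∀ {a} {A : Set a} (F : ℕ → List A) k c → c <ℕ k →
  (∀ b → b <ℕ k → b ≢ c → F b ≡ []) → concatMap F (upTo k) ≡ F c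
concatMap-upTo-single F (suc k) zero _ h = begin
    concatMap F (upTo (suc k))
  ≡⟨ cong (concatMap F) (upTo-suc k) ⟩
    F 0 ++ concatMap F (map suc (upTo k))
  ≡⟨ cong (F 0 ++_) (LP.concatMap-map F suc (upTo k)) ⟩
    F 0 ++ concatMap (F ∘ suc) (upTo k)
  ≡⟨ cong (F 0 ++_) (concatMap-≡[] (F ∘ suc) (upTo k) (λ b m → h (suc b) (s≤s (MP.∈-upTo⁻ m)) (λ ()))) ⟩
    F 0 ++ []
  ≡⟨ LP.++-identityʳ (F 0) ⟩
    F 0
  ∎
  where open ≡-Reasoning
concatMap-upTo-single F (suc k) (suc c) (s≤s c<k) h = begin
    concatMap F (upTo (suc k))
  ≡⟨ cong (concatMap F) (upTo-suc k) ⟩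
    F 0 ++ concatMap F (map suc (upTo k))
  ≡⟨ cong₂ _++_ (h 0 (s≤s z≤n) (λ ())) (LP.concatMap-map F suc (upTo k)) ⟩
    concatMap (F ∘ suc) (upTo k)
  ≡⟨ concatMap-upTo-single (F ∘ suc) k c c<k (λ b b<k b≢c → h (suc b) (s≤s b<k) (b≢c ∘ NP.suc-injective)) ⟩
    F (suc c)
  ∎
  where open ≡-Reasoning

sumℤ-++ : ∀ xs ys → sumℤ (xs ++ ys) ≡ sumℤ xs +ᶻ sumℤ ys
sumℤ-++ [] ys = sym (ZP.+-identityˡ _)
sumℤ-++ (x ∷ xs) ys = trans (cong (x +ᶻ_) (sumℤ-++ xs ys)) (sym (ZP.+-assoc x _ _))

module _ {a} {A : Set a} where

  sumℤ-cong-∈ : ∀ (f g : A → ℤ) (xs : List A) → (∀ x → x ∈ xs → f x ≡ g x) → sumℤ (map f xs) ≡ sumℤ (map g xs)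
  sumℤ-cong-∈ f g xs h = cong sumℤ (LP.map-cong-local (tabulate (h _)))

  sumℤ-zeros : ∀ (f : A → ℤ) (xs : List A) → (∀ x → x ∈ xs → f x ≡ + 0) → sumℤ (map f xs) ≡ + 0
  sumℤ-zeros f [] h = refl
  sumℤ-zeros f (x ∷ xs) h = cong₂ _+ᶻ_ (h x (here refl)) (sumℤ-zeros f xs (λ y m → h y (there m)))

  sumℤ-+ : ∀ (f g : A → ℤ) (xs : List A) →
    sumℤ (map (λ x → f x +ᶻ g x) xs) ≡ sumℤ (map f xs) +ᶻ sumℤ (map g xs)
  sumℤ-+ f g [] = refl
  sumℤ-+ f g (x ∷ xs) = trans (cong (f x +ᶻ g x +ᶻ_) (sumℤ-+ f g xs)) (interchange (f x) (g x) _ _)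
    where
    interchange : ∀ a b c d → a +ᶻ b +ᶻ (c +ᶻ d) ≡ a +ᶻ c +ᶻ (b +ᶻ d)
    interchange = solve-∀

  sumℤ-neg : ∀ (f : A → ℤ) (xs : List A) → sumℤ (map (λ x → - f x) xs) ≡ - sumℤ (map f xs)
  sumℤ-neg f [] = refl
  sumℤ-neg f (x ∷ xs) = trans (cong (- f x +ᶻ_) (sumℤ-neg f xs)) (sym (ZP.neg-distrib-+ (f x) _))

  sumℤ-scale : ∀ (c : ℤ) (f : A → ℤ) (xs : List A) → sumℤ (map (λ x → c * f x) xs) ≡ c * sumℤ (map f xs)
  sumℤ-scale c f [] = sym (ZP.*-zeroʳ c)
  sumℤ-scale c f (x ∷ xs) = trans (cong (c * f x +ᶻ_) (sumℤ-scale c f xs)) (sym (ZP.*-distribˡ-+ c (f x) _))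

  sumℤ-split : ∀ {p} {P : A → Set p} (f : A → ℤ) (P? : Decidable P) (xs : List A) →
    sumℤ (map f xs) ≡ sumℤ (map f (filter P? xs)) +ᶻ sumℤ (map f (filter (¬? ∘ P?) xs))
  sumℤ-split f P? [] = refl
  sumℤ-split f P? (x ∷ xs) with does (P? x)
  ... | true  = trans (cong (f x +ᶻ_) (sumℤ-split f P? xs)) (sym (ZP.+-assoc (f x) _ _))
  ... | false = trans (cong (f x +ᶻ_) (sumℤ-split f P? xs)) (swap (f x) (sumℤ (map f (filter P? xs))) _)
    where
    swap : ∀ a b c → a +ᶻ (b +ᶻ c) ≡ b +ᶻ (a +ᶻ c)
    swap = solve-∀

  sumℤ-concatMap : ∀ {b} {B : Set b} (f : A → ℤ) (F : B → List A) (xs : List B) →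
    sumℤ (map f (concatMap F xs)) ≡ sumℤ (map (λ y → sumℤ (map f (F y))) xs)
  sumℤ-concatMap f F [] = refl
  sumℤ-concatMap f F (x ∷ xs) = trans (cong sumℤ (LP.map-++ f (F x) (concatMap F xs)))
    (trans (sumℤ-++ (map f (F x)) _) (cong (sumℤ (map f (F x)) +ᶻ_) (sumℤ-concatMap f F xs)))

sumℤ-upTo-single : ∀ (F : ℕ → ℤ) k c → c <ℕ k → (∀ b → b <ℕ k → b ≢ c → F b ≡ + 0) →
  sumℤ (map F (upTo k)) ≡ F c
sumℤ-upTo-single F (suc k) zero _ h = begin
    sumℤ (map F (upTo (suc k)))
  ≡⟨ cong (sumℤ ∘ map F) (upTo-suc k) ⟩
    F 0 +ᶻ sumℤ (map F (map suc (upTo k)))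
  ≡⟨ cong (λ s → F 0 +ᶻ sumℤ s) (sym (LP.map-∘ (upTo k))) ⟩
    F 0 +ᶻ sumℤ (map (F ∘ suc) (upTo k))
  ≡⟨ cong (F 0 +ᶻ_) (sumℤ-zeros (F ∘ suc) (upTo k) (λ b m → h (suc b) (s≤s (MP.∈-upTo⁻ m)) (λ ()))) ⟩
    F 0 +ᶻ + 0
  ≡⟨ ZP.+-identityʳ (F 0) ⟩
    F 0
  ∎
  where open ≡-Reasoning
sumℤ-upTo-single F (suc k) (suc c) (s≤s c<k) h = begin
    sumℤ (map F (upTo (suc k)))
  ≡⟨ cong (sumℤ ∘ map F) (upTo-suc k) ⟩
    F 0 +ᶻ sumℤ (map F (map suc (upTo k)))
  ≡⟨ cong₂ _+ᶻ_ (h 0 (s≤s z≤n) (λ ())) (cong sumℤ (sym (LP.map-∘ (upTo k)))) ⟩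
    + 0 +ᶻ sumℤ (map (F ∘ suc) (upTo k))
  ≡⟨ ZP.+-identityˡ _ ⟩
    sumℤ (map (F ∘ suc) (upTo k))
  ≡⟨ sumℤ-upTo-single (F ∘ suc) k c c<k (λ b b<k b≢c → h (suc b) (s≤s b<k) (b≢c ∘ NP.suc-injective)) ⟩
    F (suc c)
  ∎
  where open ≡-Reasoning

sumℤ-upTo-suc : ∀ (F : ℕ → ℤ) s → sumℤ (map F (upTo (suc s))) ≡ sumℤ (map F (upTo s)) +ᶻ F s
sumℤ-upTo-suc F s = begin
    sumℤ (map F (upTo (suc s)))
  ≡⟨ cong (sumℤ ∘ map F) (sym (LP.upTo-∷ʳ s)) ⟩
    sumℤ (map F (upTo s ++ s ∷ []))
  ≡⟨ cong sumℤ (LP.map-++ F (upTo s) (s ∷ [])) ⟩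
    sumℤ (map F (upTo s) ++ F s ∷ [])
  ≡⟨ sumℤ-++ (map F (upTo s)) (F s ∷ []) ⟩
    sumℤ (map F (upTo s)) +ᶻ (F s +ᶻ + 0)
  ≡⟨ cong (sumℤ (map F (upTo s)) +ᶻ_) (ZP.+-identityʳ (F s)) ⟩
    sumℤ (map F (upTo s)) +ᶻ F s
  ∎
  where open ≡-Reasoning

sumℤ-zip : ∀ {a b} {A : Set a} {B : Set b} (f : A → ℤ) (g : B → ℤ) (xs : List A) (ys : List B) →
  length xs ≡ length ys → (∀ x y → (x , y) ∈ zip xs ys → f x ≡ g y) → sumℤ (map f xs) ≡ sumℤ (map g ys)
sumℤ-zip f g [] [] _ h = refl
sumℤ-zip f g (x ∷ xs) (y ∷ ys) l h =
  cong₂ _+ᶻ_ (h x y (here refl)) (sumℤ-zip f g xs ys (NP.suc-injective l) (λ x′ y′ m → h x′ y′ (there m)))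

-- Refinement as a functional relation

T-ext : ∀ {a b : Bool} → (T a → T b) → (T b → T a) → a ≡ b
T-ext f g = does-⇔ (mk⇔ f g) (T? _) (T? _)

T-implies⁻ : ∀ a c b d → T (not (a ≡ᵇ c) ∨ (b ≡ᵇ d)) → a ≡ c → b ≡ d
T-implies⁻ a c b d t refl with a ≡ᵇ a | NP.≡⇒≡ᵇ a a refl
... | true | _ = NP.≡ᵇ⇒≡ b d t

T-implies⁺ : ∀ a c b d → (a ≡ c → b ≡ d) → T (not (a ≡ᵇ c) ∨ (b ≡ᵇ d))
T-implies⁺ a c b d h with a ≡ᵇ c in e
... | false = tt
... | true  = NP.≡⇒≡ᵇ b d (h (NP.≡ᵇ⇒≡ a c (subst T (sym e) tt)))

Functional : List (ℕ × ℕ) → Set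
Functional Z = ∀ {a b c d} → (a , b) ∈ Z → (c , d) ∈ Z → a ≡ c → b ≡ d

Functional-anti : ∀ {Z W} → Z ⊆ W → Functional W → Functional Z
Functional-anti Z⊆W fun m₁ m₂ = fun (Z⊆W m₁) (Z⊆W m₂)

≤ᵇ⇒Functional : ∀ x y → T (x ≤ᵇ y) → Functional (zip x y)
≤ᵇ⇒Functional x y t {a} {b} {c} {d} m₁ m₂ =
  T-implies⁻ a c b d (lookup (AllP.all⁺ _ (cartesianProduct (zip x y) (zip x y)) t) (MP.∈-cartesianProduct⁺ m₁ m₂))

Functional⇒≤ᵇ : ∀ x y → Functional (zip x y) → T (x ≤ᵇ y)
Functional⇒≤ᵇ x y fun = AllP.all⁻ _ {xs = cartesianProduct (zip x y) (zip x y)} (tabulate λ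
  { {(a , b) , (c , d)} m → let m₁ , m₂ = MP.∈-cartesianProduct⁻ (zip x y) (zip x y) m
                             in T-implies⁺ a c b d (fun m₁ m₂) })

≤ᵇ-ext : ∀ x y x′ y′ → (Functional (zip x y) → Functional (zip x′ y′)) →
  (Functional (zip x′ y′) → Functional (zip x y)) → (x ≤ᵇ y) ≡ (x′ ≤ᵇ y′)
≤ᵇ-ext x y x′ y′ f g =
  T-ext (Functional⇒≤ᵇ x′ y′ ∘ f ∘ ≤ᵇ⇒Functional x y) (Functional⇒≤ᵇ x y ∘ g ∘ ≤ᵇ⇒Functional x′ y′)

zip-self : ∀ (x : List ℕ) {a b} → (a , b) ∈ zip x x → a ≡ b
zip-self (y ∷ x) (here refl) = refl
zip-self (y ∷ x) (there m) = zip-self x m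

≤ᵇ-refl : ∀ x → (x ≤ᵇ x) ≡ true
≤ᵇ-refl x = dec-true (T? _) (Functional⇒≤ᵇ x x λ m₁ m₂ e → trans (sym (zip-self x m₁)) (trans e (zip-self x m₂)))

functionalᵇ : List (ℕ × ℕ) → Bool
functionalᵇ Z = map proj₁ Z ≤ᵇ map proj₂ Z

zip-unzip : ∀ (Z : List (ℕ × ℕ)) → zip (map proj₁ Z) (map proj₂ Z) ≡ Z
zip-unzip [] = refl
zip-unzip (q ∷ Z) = cong (q ∷_) (zip-unzip Z)

T-functionalᵇ⁻ : ∀ Z → T (functionalᵇ Z) → Functional Z
T-functionalᵇ⁻ Z t = subst Functional (zip-unzip Z) (≤ᵇ⇒Functional (map proj₁ Z) (map proj₂ Z) t)

T-functionalᵇ⁺ : ∀ Z → Functional Z → T (functionalᵇ Z)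
T-functionalᵇ⁺ Z fun = Functional⇒≤ᵇ (map proj₁ Z) (map proj₂ Z) (subst Functional (sym (zip-unzip Z)) fun)

functionalᵇ-ext : ∀ Z W → (Functional Z → Functional W) → (Functional W → Functional Z) →
  functionalᵇ Z ≡ functionalᵇ W
functionalᵇ-ext Z W f g = T-ext (T-functionalᵇ⁺ W ∘ f ∘ T-functionalᵇ⁻ Z) (T-functionalᵇ⁺ Z ∘ g ∘ T-functionalᵇ⁻ W)

zip-∈₁ : ∀ {a b} {A : Set a} {B : Set b} (xs : List A) (ys : List B) {c d} → (c , d) ∈ zip xs ys → c ∈ xs
zip-∈₁ (x ∷ xs) (y ∷ ys) (here refl) = here refl
zip-∈₁ (x ∷ xs) (y ∷ ys) (there m) = there (zip-∈₁ xs ys m)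

zip-∈₂ : ∀ {a b} {A : Set a} {B : Set b} (xs : List A) (ys : List B) {c d} → (c , d) ∈ zip xs ys → d ∈ ys
zip-∈₂ (x ∷ xs) (y ∷ ys) (here refl) = here refl
zip-∈₂ (x ∷ xs) (y ∷ ys) (there m) = there (zip-∈₂ xs ys m)

-- Restricted growth strings

==⇒≡ : ∀ x y → (x == y) ≡ true → x ≡ y
==⇒≡ x y e with LP.≡-dec NP._≟_ x y
... | yes x≡y = x≡y

==-false⇒≢ : ∀ x y → (x == y) ≡ false → x ≢ y
==-false⇒≢ x y e with LP.≡-dec NP._≟_ x y
... | no x≢y = x≢y

==-refl : ∀ x → (x == x) ≡ true
==-refl x = dec-true (LP.≡-dec NP._≟_ x x) refl

nextCount : ℕ → ℕ → ℕ
nextCount b s = if b ≡ᵇ s then suc s else s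

label<nextCount : ∀ b s → b ≤ℕ s → b <ℕ nextCount b s
label<nextCount b s b≤s with b ≡ᵇ s in e
... | true  = s≤s b≤s
... | false = NP.≤∧≢⇒< b≤s (λ b≡s → subst T e (NP.≡⇒≡ᵇ b s b≡s))

nextCount-used : ∀ b s → b <ℕ s → nextCount b s ≡ s
nextCount-used b s b<s with b ≡ᵇ s in e
... | false = refl
... | true  = ⊥-elim (NP.<⇒≢ b<s (NP.≡ᵇ⇒≡ b s (subst T (sym e) tt)))

nextCount-fresh : ∀ s → nextCount s s ≡ suc s
nextCount-fresh s with s ≡ᵇ s in e
... | true  = refl
... | false = ⊥-elim (subst T e (NP.≡⇒≡ᵇ s s refl))

≤-nextCount : ∀ b s → s ≤ℕ nextCount b s
≤-nextCount b s with b ≡ᵇ s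
... | true  = NP.n≤1+n s
... | false = NP.≤-refl

nextCount-≤ : ∀ b s → nextCount b s ≤ℕ suc s
nextCount-≤ b s with b ≡ᵇ s
... | true  = NP.≤-refl
... | false = NP.n≤1+n s

data RGS : ℕ → List ℕ → Set where
  []  : ∀ {s} → RGS s []
  _∷_ : ∀ {s b t} → b ≤ℕ s → RGS (nextCount b s) t → RGS s (b ∷ t)

∈-gen⁻ : ∀ r s {x} → x ∈ gen (suc r) s →
  ∃ λ b → ∃ λ t → x ≡ b ∷ t × b ≤ℕ s × t ∈ gen r (nextCount b s)
∈-gen⁻ r s m with find (MP.∈-concatMap⁻ (λ b → map (b ∷_) (gen r (nextCount b s))) {xs = upTo (suc s)} m)
... | b , b∈ , x∈ with MP.∈-map⁻ (b ∷_) x∈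
... | t , t∈ , refl = b , t , refl , NP.≤-pred (MP.∈-upTo⁻ b∈) , t∈

∈-gen⇒length : ∀ r s {x} → x ∈ gen r s → length x ≡ r
∈-gen⇒length zero s (here refl) = refl
∈-gen⇒length (suc r) s m with ∈-gen⁻ r s m
... | b , t , refl , _ , t∈ = cong suc (∈-gen⇒length r (nextCount b s) t∈)

∈-gen⇒RGS : ∀ r s {x} → x ∈ gen r s → RGS s x
∈-gen⇒RGS zero s (here refl) = []
∈-gen⇒RGS (suc r) s m with ∈-gen⁻ r s m
... | b , t , refl , b≤s , t∈ = b≤s ∷ ∈-gen⇒RGS r (nextCount b s) t∈

gen-occurs-once : ∀ r s σ → σ ∈ gen r s → filter (λ z → T? (z == σ)) (gen r s) ≡ σ ∷ []
gen-occurs-once zero s σ (here refl) = refl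
gen-occurs-once (suc r) s σ m with ∈-gen⁻ r s m
... | b , t , refl , b≤s , t∈ = begin
    filter Eq? (concatMap Branch (upTo (suc s)))
  ≡⟨ filter-concatMap Eq? Branch (upTo (suc s)) ⟩
    concatMap (filter Eq? ∘ Branch) (upTo (suc s))
  ≡⟨ concatMap-upTo-single (filter Eq? ∘ Branch) (suc s) b (s≤s b≤s) otherBranch ⟩
    filter Eq? (map (b ∷_) (gen r (nextCount b s)))
  ≡⟨ filter-map Eq? (b ∷_) (gen r (nextCount b s)) ⟩
    map (b ∷_) (filter (Eq? ∘ (b ∷_)) (gen r (nextCount b s)))
  ≡⟨ cong (map (b ∷_)) (filter-cong-∈ (Eq? ∘ (b ∷_)) (λ z → T? (z == t)) (gen r (nextCount b s))
       (λ z _ → does-⇔ (mk⇔ (proj₂ ∘ LP.∷-injective) (cong (b ∷_)))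
                        (LP.≡-dec NP._≟_ (b ∷ z) (b ∷ t)) (LP.≡-dec NP._≟_ z t))) ⟩
    map (b ∷_) (filter (λ z → T? (z == t)) (gen r (nextCount b s)))
  ≡⟨ cong (map (b ∷_)) (gen-occurs-once r (nextCount b s) t t∈) ⟩
    (b ∷ t) ∷ []
  ∎
  where
  open ≡-Reasoning
  Eq? : Decidable (λ z → T (z == (b ∷ t)))
  Eq? z = T? (z == (b ∷ t))
  Branch : ℕ → List (List ℕ)
  Branch b′ = map (b′ ∷_) (gen r (nextCount b′ s))
  otherBranch : ∀ b′ → b′ <ℕ suc s → b′ ≢ b → filter Eq? (Branch b′) ≡ []
  otherBranch b′ _ b′≢b = trans (filter-map Eq? (b′ ∷_) (gen r (nextCount b′ s)))
    (cong (map (b′ ∷_)) (filter-none-∈ (Eq? ∘ (b′ ∷_)) (gen r (nextCount b′ s))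
      (λ z _ → dec-false (T? _) (b′≢b ∘ proj₁ ∘ LP.∷-injective ∘ ==⇒≡ (b′ ∷ z) (b ∷ t) ∘ dec-true (T? _)))))

finalCount : ℕ → List ℕ → ℕ
finalCount s [] = s
finalCount s (b ∷ t) = finalCount (nextCount b s) t

finalCount-≤ : ∀ s t → finalCount s t ≤ℕ s +ℕ length t
finalCount-≤ s [] = NP.≤-reflexive (sym (NP.+-identityʳ s))
finalCount-≤ s (b ∷ t) = begin
    finalCount (nextCount b s) t
  ≤⟨ finalCount-≤ (nextCount b s) t ⟩
    nextCount b s +ℕ length t
  ≤⟨ NP.+-monoˡ-≤ (length t) (nextCount-≤ b s) ⟩
    suc s +ℕ length t
  ≡⟨ sym (NP.+-suc s (length t)) ⟩
    s +ℕ length (b ∷ t)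
  ∎
  where open NP.≤-Reasoning

Bounded : ℕ → List ℕ → Set
Bounded s xs = ∀ b → b ∈ xs → b <ℕ s

Covers : ℕ → List ℕ → Set
Covers s xs = ∀ b → b <ℕ s → b ∈ xs

Covers-∷ : ∀ s acc b → Covers s acc → b ≤ℕ s → Covers (nextCount b s) (b ∷ acc)
Covers-∷ s acc b cov b≤s b′ b′< with b ≡ᵇ s in e
... | false = there (cov b′ b′<)
... | true with NP.m≤n⇒m<n∨m≡n (NP.≤-pred b′<)
...   | inj₁ b′<s = there (cov b′ b′<s)
...   | inj₂ b′≡s = here (trans b′≡s (sym (NP.≡ᵇ⇒≡ b s (subst T (sym e) tt))))

Bounded-∷ : ∀ s acc c → Bounded s acc → c ≤ℕ s → Bounded (nextCount c s) (c ∷ acc)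
Bounded-∷ s acc c bnd c≤s .c (here refl) = label<nextCount c s c≤s
Bounded-∷ s acc c bnd c≤s c′ (there m) = NP.<-≤-trans (bnd c′ m) (≤-nextCount c s)

zip-shift : ∀ (A B z σ : List ℕ) b c → zip (b ∷ A) (c ∷ B) ++ zip z σ ⊆ zip A B ++ zip (b ∷ z) (c ∷ σ)
zip-shift A B z σ b c (here e) = MP.∈-++⁺ʳ (zip A B) (here e)
zip-shift A B z σ b c (there m) with MP.∈-++⁻ (zip A B) m
... | inj₁ m₁ = MP.∈-++⁺ˡ m₁
... | inj₂ m₂ = MP.∈-++⁺ʳ (zip A B) (there m₂)

zip-unshift : ∀ (A B z σ : List ℕ) b c → zip A B ++ zip (b ∷ z) (c ∷ σ) ⊆ zip (b ∷ A) (c ∷ B) ++ zip z σ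
zip-unshift A B z σ b c m with MP.∈-++⁻ (zip A B) m
... | inj₁ m₁ = there (MP.∈-++⁺ˡ m₁)
... | inj₂ (here e) = here e
... | inj₂ (there m₂) = there (MP.∈-++⁺ʳ (zip A B) m₂)

zip-partner : ∀ (A B : List ℕ) → length A ≡ length B → ∀ {b} → b ∈ A → ∃ λ c → (b , c) ∈ zip A B
zip-partner (a ∷ A) (c ∷ B) _ (here refl) = c , here refl
zip-partner (a ∷ A) (c ∷ B) l (there m) with zip-partner A B (NP.suc-injective l) m
... | c′ , m′ = c′ , there m′

zip-diagonal : ∀ (A : List ℕ) {b} → b ∈ A → (b , b) ∈ zip A A
zip-diagonal (a ∷ A) (here refl) = here refl
zip-diagonal (a ∷ A) (there m) = there (zip-diagonal A m)

-- Reading a refinement z ≤ σ of restricted growth strings left to right, every new label of σ forces a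
-- new label of z: otherwise an old block of z would meet both an old block of σ and the new one.
finalCount-mono : ∀ z σ accz accσ sz sσ → length z ≡ length σ → length accz ≡ length accσ →
  RGS sz z → RGS sσ σ → Covers sz accz → Bounded sσ accσ → Functional (zip accz accσ ++ zip z σ) →
  finalCount sσ σ +ℕ sz ≤ℕ finalCount sz z +ℕ sσ
finalCount-mono [] [] _ _ sz sσ _ _ _ _ _ _ _ = NP.≤-reflexive (NP.+-comm sσ sz)
finalCount-mono (b ∷ z) (c ∷ σ) accz accσ sz sσ lz la (b≤ ∷ rz) (c≤ ∷ rσ) cov bnd fun
  with NP.m≤n⇒m<n∨m≡n c≤
... | inj₁ c<sσ = NP.≤-trans (NP.+-monoʳ-≤ (finalCount (nextCount c sσ) σ) (≤-nextCount b sz))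
        (subst (λ u → finalCount (nextCount c sσ) σ +ℕ nextCount b sz ≤ℕ finalCount (nextCount b sz) z +ℕ u)
          (nextCount-used c sσ c<sσ) ih)
  where
  ih : finalCount (nextCount c sσ) σ +ℕ nextCount b sz ≤ℕ finalCount (nextCount b sz) z +ℕ nextCount c sσ
  ih = finalCount-mono z σ (b ∷ accz) (c ∷ accσ) (nextCount b sz) (nextCount c sσ) (NP.suc-injective lz)
         (cong suc la) rz rσ (Covers-∷ sz accz b cov b≤) (Bounded-∷ sσ accσ c bnd c≤)
         (Functional-anti (zip-shift accz accσ z σ b c) fun)
... | inj₂ refl with NP.m≤n⇒m<n∨m≡n b≤
...   | inj₁ b<sz = ⊥-elim (NP.<-irrefl partner≡ (bnd _ (zip-∈₂ accz accσ (proj₂ partner))))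
  where
  partner : ∃ λ c → (b , c) ∈ zip accz accσ
  partner = zip-partner accz accσ la (cov b b<sz)
  partner≡ : proj₁ partner ≡ sσ
  partner≡ = fun (MP.∈-++⁺ˡ (proj₂ partner)) (MP.∈-++⁺ʳ (zip accz accσ) (here refl)) refl
...   | inj₂ refl = subst₂ (λ u v → finalCount u σ +ℕ sz ≤ℕ finalCount v z +ℕ sσ)
                      (sym (nextCount-fresh sσ)) (sym (nextCount-fresh sz)) (NP.≤-pred ih′)
  where
  ih : finalCount (nextCount sσ sσ) σ +ℕ nextCount sz sz ≤ℕ finalCount (nextCount sz sz) z +ℕ nextCount sσ sσ
  ih = finalCount-mono z σ (sz ∷ accz) (sσ ∷ accσ) (nextCount sz sz) (nextCount sσ sσ) (NP.suc-injective lz)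
         (cong suc la) rz rσ (Covers-∷ sz accz sz cov b≤) (Bounded-∷ sσ accσ sσ bnd c≤)
         (Functional-anti (zip-shift accz accσ z σ sz sσ) fun)
  ih′ : suc (finalCount (suc sσ) σ +ℕ sz) ≤ℕ suc (finalCount (suc sz) z +ℕ sσ)
  ih′ = subst₂ _≤ℕ_ (NP.+-suc (finalCount (suc sσ) σ) sz) (NP.+-suc (finalCount (suc sz) z) sσ)
          (subst₂ (λ u v → finalCount u σ +ℕ v ≤ℕ finalCount v z +ℕ u) (nextCount-fresh sσ) (nextCount-fresh sz) ih)

-- At the first position where a refinement z of σ differs from σ, z opens a new block while σ does not.
finalCount-strict : ∀ z σ acc s → length z ≡ length σ → RGS s z → RGS s σ → Covers s acc → Bounded s acc →
  Functional (zip acc acc ++ zip z σ) → z ≢ σ → finalCount s σ <ℕ finalCount s z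
finalCount-strict [] [] _ _ _ _ _ _ _ _ z≢σ = ⊥-elim (z≢σ refl)
finalCount-strict (b ∷ z) (c ∷ σ) acc s lz (b≤ ∷ rz) (c≤ ∷ rσ) cov bnd fun z≢σ with b NP.≟ c
... | yes refl = finalCount-strict z σ (b ∷ acc) (nextCount b s) (NP.suc-injective lz) rz rσ
       (Covers-∷ s acc b cov b≤) (Bounded-∷ s acc b bnd b≤) (Functional-anti (zip-shift acc acc z σ b b) fun)
       (z≢σ ∘ cong (b ∷_))
... | no b≢c with NP.m≤n⇒m<n∨m≡n b≤
...   | inj₁ b<s = ⊥-elim (b≢c (fun (MP.∈-++⁺ˡ (zip-diagonal acc (cov b b<s))) (MP.∈-++⁺ʳ (zip acc acc) (here refl)) refl))
...   | inj₂ refl = subst₂ (λ u v → finalCount u σ <ℕ finalCount v z)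
                      (sym (nextCount-used c b c<b)) (sym (nextCount-fresh b))
                      (NP.+-cancelʳ-≤ b _ _ (subst (_≤ℕ finalCount (suc b) z +ℕ b) (NP.+-suc (finalCount b σ) b) mono′))
  where
  c<b : c <ℕ b
  c<b = NP.≤∧≢⇒< c≤ (b≢c ∘ sym)
  mono : finalCount (nextCount c b) σ +ℕ nextCount b b ≤ℕ finalCount (nextCount b b) z +ℕ nextCount c b
  mono = finalCount-mono z σ (b ∷ acc) (c ∷ acc) (nextCount b b) (nextCount c b) (NP.suc-injective lz) refl rz rσ
           (Covers-∷ b acc b cov b≤) (Bounded-∷ b acc c bnd c≤) (Functional-anti (zip-shift acc acc z σ b c) fun)
  mono′ : finalCount b σ +ℕ suc b ≤ℕ finalCount (suc b) z +ℕ b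
  mono′ = subst₂ (λ u v → finalCount u σ +ℕ v ≤ℕ finalCount v z +ℕ u) (nextCount-used c b c<b) (nextCount-fresh b) mono

-- Expansion along a composition

-- expand λ sends a partition of [ℓ(λ)] to the partition of [n] that merges the blocks of Π(λ) accordingly.
expand : List ℕ → List ℕ → List ℕ
expand (p ∷ ps) (b ∷ σ) = replicate p b ++ expand ps σ
expand _ _ = []

ascending : ℕ → ℕ → List ℕ
ascending i zero = []
ascending i (suc m) = i ∷ ascending (suc i) m

length-ascending : ∀ i m → length (ascending i m) ≡ m
length-ascending i zero = refl
length-ascending i (suc m) = cong suc (length-ascending (suc i) m)

Πgo≡expand-ascending : ∀ i λ′ → Πgo i λ′ ≡ expand λ′ (ascending i (length λ′))
Πgo≡expand-ascending i [] = refl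
Πgo≡expand-ascending i (p ∷ ps) = cong (replicate p i ++_) (Πgo≡expand-ascending (suc i) ps)

∈-replicate⁻ : ∀ {a} {A : Set a} n {b x : A} → x ∈ replicate n b → x ≡ b
∈-replicate⁻ (suc n) (here e) = e
∈-replicate⁻ (suc n) (there m) = ∈-replicate⁻ n m

Πgo-≥ : ∀ i ps {c} → c ∈ Πgo i ps → i ≤ℕ c
Πgo-≥ i (p ∷ ps) m with MP.∈-++⁻ (replicate p i) m
... | inj₁ m₁ = NP.≤-reflexive (sym (∈-replicate⁻ p m₁))
... | inj₂ m₂ = NP.<⇒≤ (Πgo-≥ (suc i) ps m₂)

≤ᵇ-repeat : ∀ j X b t → ((j ∷ j ∷ X) ≤ᵇ (b ∷ b ∷ t)) ≡ ((j ∷ X) ≤ᵇ (b ∷ t))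
≤ᵇ-repeat j X b t = ≤ᵇ-ext (j ∷ j ∷ X) (b ∷ b ∷ t) (j ∷ X) (b ∷ t) (Functional-anti there) (Functional-anti merge)
  where
  merge : zip (j ∷ j ∷ X) (b ∷ b ∷ t) ⊆ zip (j ∷ X) (b ∷ t)
  merge (here e) = here e
  merge (there (here e)) = here e
  merge (there (there m)) = there m

≤ᵇ-repeat-split : ∀ j X b b′ t → b′ ≢ b → ((j ∷ j ∷ X) ≤ᵇ (b ∷ b′ ∷ t)) ≡ false
≤ᵇ-repeat-split j X b b′ t b′≢b = dec-false (T? _)
  (λ le → b′≢b (≤ᵇ⇒Functional (j ∷ j ∷ X) (b ∷ b′ ∷ t) le (there (here refl)) (here refl) refl))

≤ᵇ-fresh-head : ∀ j Y b t → ¬ j ∈ Y → ((j ∷ Y) ≤ᵇ (b ∷ t)) ≡ (Y ≤ᵇ t)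
≤ᵇ-fresh-head j Y b t j∉Y = ≤ᵇ-ext (j ∷ Y) (b ∷ t) Y t (Functional-anti there) extend
  where
  extend : Functional (zip Y t) → Functional (zip (j ∷ Y) (b ∷ t))
  extend fun (here refl) (here refl) e = refl
  extend fun (here refl) (there m₂) refl = ⊥-elim (j∉Y (zip-∈₁ Y t m₂))
  extend fun (there m₁) (here refl) refl = ⊥-elim (j∉Y (zip-∈₁ Y t m₁))
  extend fun (there m₁) (there m₂) e = fun m₁ m₂ e

filter-above-block : ∀ p r s b j Y → b <ℕ s → ¬ j ∈ Y →
  filter (λ t → T? ((replicate (suc p) j ++ Y) ≤ᵇ (b ∷ t))) (gen (p +ℕ r) s)
  ≡ map (replicate p b ++_) (filter (λ u → T? (Y ≤ᵇ u)) (gen r s))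
filter-above-block zero r s b j Y b<s j∉Y =
  trans (filter-cong-∈ _ (λ u → T? (Y ≤ᵇ u)) (gen r s) (λ t _ → ≤ᵇ-fresh-head j Y b t j∉Y)) (sym (LP.map-id _))
filter-above-block (suc p) r s b j Y b<s j∉Y = begin
    filter Above (gen (suc (p +ℕ r)) s)
  ≡⟨ filter-concatMap Above Branch (upTo (suc s)) ⟩
    concatMap (filter Above ∘ Branch) (upTo (suc s))
  ≡⟨ concatMap-upTo-single (filter Above ∘ Branch) (suc s) b (NP.m≤n⇒m≤1+n b<s) otherBranch ⟩
    filter Above (map (b ∷_) (gen (p +ℕ r) (nextCount b s)))
  ≡⟨ filter-map Above (b ∷_) (gen (p +ℕ r) (nextCount b s)) ⟩
    map (b ∷_) (filter (Above ∘ (b ∷_)) (gen (p +ℕ r) (nextCount b s)))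
  ≡⟨ cong (λ u → map (b ∷_) (filter (Above ∘ (b ∷_)) (gen (p +ℕ r) u))) (nextCount-used b s b<s) ⟩
    map (b ∷_) (filter (Above ∘ (b ∷_)) (gen (p +ℕ r) s))
  ≡⟨ cong (map (b ∷_)) (filter-cong-∈ (Above ∘ (b ∷_)) Above′ (gen (p +ℕ r) s)
       (λ t _ → ≤ᵇ-repeat j (replicate p j ++ Y) b t)) ⟩
    map (b ∷_) (filter Above′ (gen (p +ℕ r) s))
  ≡⟨ cong (map (b ∷_)) (filter-above-block p r s b j Y b<s j∉Y) ⟩
    map (b ∷_) (map (replicate p b ++_) (filter (λ u → T? (Y ≤ᵇ u)) (gen r s)))
  ≡⟨ sym (LP.map-∘ _) ⟩
    map (replicate (suc p) b ++_) (filter (λ u → T? (Y ≤ᵇ u)) (gen r s))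
  ∎
  where
  open ≡-Reasoning
  Above : Decidable (λ t → T ((replicate (suc (suc p)) j ++ Y) ≤ᵇ (b ∷ t)))
  Above t = T? ((replicate (suc (suc p)) j ++ Y) ≤ᵇ (b ∷ t))
  Above′ : Decidable (λ t → T ((replicate (suc p) j ++ Y) ≤ᵇ (b ∷ t)))
  Above′ t = T? ((replicate (suc p) j ++ Y) ≤ᵇ (b ∷ t))
  Branch : ℕ → List (List ℕ)
  Branch b′ = map (b′ ∷_) (gen (p +ℕ r) (nextCount b′ s))
  otherBranch : ∀ b′ → b′ <ℕ suc s → b′ ≢ b → filter Above (Branch b′) ≡ []
  otherBranch b′ _ b′≢b = trans (filter-map Above (b′ ∷_) (gen (p +ℕ r) (nextCount b′ s)))
    (cong (map (b′ ∷_)) (filter-none-∈ (Above ∘ (b′ ∷_)) (gen (p +ℕ r) (nextCount b′ s))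
       (λ t _ → ≤ᵇ-repeat-split j (replicate p j ++ Y) b b′ t b′≢b)))

filter-above-Πgo : ∀ λ′ → All (0 <ℕ_) λ′ → ∀ j s →
  filter (λ Λ → T? (Πgo j λ′ ≤ᵇ Λ)) (gen (sum λ′) s) ≡ map (expand λ′) (gen (length λ′) s)
filter-above-Πgo [] [] j s = refl
filter-above-Πgo (suc p ∷ ps) (_ ∷ pos) j s = begin
    filter Above (gen (suc (p +ℕ sum ps)) s)
  ≡⟨ filter-concatMap Above Branch (upTo (suc s)) ⟩
    concatMap (filter Above ∘ Branch) (upTo (suc s))
  ≡⟨ cong concat (LP.map-cong-local (tabulate (branch _))) ⟩
    concatMap Expanded (upTo (suc s))
  ≡⟨ sym (LP.map-concatMap (expand (suc p ∷ ps)) (λ b → map (b ∷_) (gen (length ps) (nextCount b s))) (upTo (suc s))) ⟩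
    map (expand (suc p ∷ ps)) (gen (length (suc p ∷ ps)) s)
  ∎
  where
  open ≡-Reasoning
  Y : List ℕ
  Y = Πgo (suc j) ps
  Above : Decidable (λ Λ → T (Πgo j (suc p ∷ ps) ≤ᵇ Λ))
  Above Λ = T? (Πgo j (suc p ∷ ps) ≤ᵇ Λ)
  Branch Expanded : ℕ → List (List ℕ)
  Branch b = map (b ∷_) (gen (p +ℕ sum ps) (nextCount b s))
  Expanded b = map (expand (suc p ∷ ps)) (map (b ∷_) (gen (length ps) (nextCount b s)))
  j∉Y : ¬ j ∈ Y
  j∉Y m = NP.<-irrefl refl (Πgo-≥ (suc j) ps m)
  branch : ∀ b → b ∈ upTo (suc s) → filter Above (Branch b) ≡ Expanded b
  branch b b∈ = begin
      filter Above (Branch b)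
    ≡⟨ filter-map Above (b ∷_) (gen (p +ℕ sum ps) (nextCount b s)) ⟩
      map (b ∷_) (filter (Above ∘ (b ∷_)) (gen (p +ℕ sum ps) (nextCount b s)))
    ≡⟨ cong (map (b ∷_)) (filter-above-block p (sum ps) (nextCount b s) b j Y
         (label<nextCount b s (NP.≤-pred (MP.∈-upTo⁻ b∈))) j∉Y) ⟩
      map (b ∷_) (map (replicate p b ++_) (filter (λ u → T? (Y ≤ᵇ u)) (gen (sum ps) (nextCount b s))))
    ≡⟨ cong (map (b ∷_) ∘ map (replicate p b ++_)) (filter-above-Πgo ps pos (suc j) (nextCount b s)) ⟩
      map (b ∷_) (map (replicate p b ++_) (map (expand ps) (gen (length ps) (nextCount b s))))
    ≡⟨ sym (trans (LP.map-∘ _) (LP.map-∘ _)) ⟩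
      map (λ σ → b ∷ (replicate p b ++ expand ps σ)) (gen (length ps) (nextCount b s))
    ≡⟨ LP.map-∘ _ ⟩
      Expanded b
    ∎

zip-replicate-++ : ∀ p (a b : ℕ) xs ys →
  zip (replicate p a ++ xs) (replicate p b ++ ys) ≡ replicate p (a , b) ++ zip xs ys
zip-replicate-++ zero a b xs ys = refl
zip-replicate-++ (suc p) a b xs ys = cong ((a , b) ∷_) (zip-replicate-++ p a b xs ys)

zip-expand⁻ : ∀ λ′ σ′ σ → length σ ≡ length λ′ → zip (expand λ′ σ′) (expand λ′ σ) ⊆ zip σ′ σ
zip-expand⁻ (p ∷ ps) (b′ ∷ σ′) (b ∷ σ) l m rewrite zip-replicate-++ p b′ b (expand ps σ′) (expand ps σ)
  with MP.∈-++⁻ (replicate p (b′ , b)) m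
... | inj₁ m₁ = here (∈-replicate⁻ p m₁)
... | inj₂ m₂ = there (zip-expand⁻ ps σ′ σ (NP.suc-injective l) m₂)

zip-expand⁺ : ∀ λ′ → All (0 <ℕ_) λ′ → ∀ σ′ σ → length σ′ ≡ length λ′ → zip σ′ σ ⊆ zip (expand λ′ σ′) (expand λ′ σ)
zip-expand⁺ (suc p ∷ ps) (_ ∷ pos) (b′ ∷ σ′) (b ∷ σ) l (here refl) = here refl
zip-expand⁺ (suc p ∷ ps) (_ ∷ pos) (b′ ∷ σ′) (b ∷ σ) l (there m)
  rewrite zip-replicate-++ p b′ b (expand ps σ′) (expand ps σ) =
  there (MP.∈-++⁺ʳ (replicate p (b′ , b)) (zip-expand⁺ ps pos σ′ σ (NP.suc-injective l) m))

expand-≤ᵇ : ∀ λ′ → All (0 <ℕ_) λ′ → ∀ σ′ σ → length σ′ ≡ length λ′ → length σ ≡ length λ′ →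
  (expand λ′ σ′ ≤ᵇ expand λ′ σ) ≡ (σ′ ≤ᵇ σ)
expand-≤ᵇ λ′ pos σ′ σ l′ l = ≤ᵇ-ext (expand λ′ σ′) (expand λ′ σ) σ′ σ
  (Functional-anti (zip-expand⁺ λ′ pos σ′ σ l′)) (Functional-anti (zip-expand⁻ λ′ σ′ σ l))

expand-injective : ∀ λ′ → All (0 <ℕ_) λ′ → ∀ σ′ σ → length σ′ ≡ length λ′ → length σ ≡ length λ′ →
  expand λ′ σ′ ≡ expand λ′ σ → σ′ ≡ σ
expand-injective [] [] [] [] _ _ _ = refl
expand-injective (suc p ∷ ps) (_ ∷ pos) (b′ ∷ σ′) (b ∷ σ) l′ l e
  with b′≡b , rest ← LP.∷-injective e rewrite b′≡b =
  cong (b ∷_) (expand-injective ps pos σ′ σ (NP.suc-injective l′) (NP.suc-injective l)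
    (LP.++-cancelˡ (replicate p b) (expand ps σ′) (expand ps σ) rest))

expand-== : ∀ λ′ → All (0 <ℕ_) λ′ → ∀ σ′ σ → length σ′ ≡ length λ′ → length σ ≡ length λ′ →
  (expand λ′ σ′ == expand λ′ σ) ≡ (σ′ == σ)
expand-== λ′ pos σ′ σ l′ l = does-⇔ (mk⇔ (expand-injective λ′ pos σ′ σ l′ l) (cong (expand λ′)))
  (LP.≡-dec NP._≟_ (expand λ′ σ′) (expand λ′ σ)) (LP.≡-dec NP._≟_ σ′ σ)

deduplicate-drop-replicate : ∀ p b R → filter (¬? ∘ (b NP.≟_)) (labels (replicate p b ++ R))
                                     ≡ filter (¬? ∘ (b NP.≟_)) (labels R)
deduplicate-drop-replicate zero b R = refl
deduplicate-drop-replicate (suc p) b R with b ≡ᵇ b | NP.≡⇒≡ᵇ b b refl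
... | true | _ = trans (LP.filter-idem (¬? ∘ (b NP.≟_)) (labels (replicate p b ++ R))) (deduplicate-drop-replicate p b R)

labels-expand : ∀ λ′ → All (0 <ℕ_) λ′ → ∀ σ → length σ ≡ length λ′ → labels (expand λ′ σ) ≡ labels σ
labels-expand [] [] [] _ = refl
labels-expand (suc p ∷ ps) (_ ∷ pos) (b ∷ σ) l = cong (b ∷_)
  (trans (deduplicate-drop-replicate p b (expand ps σ))
         (cong (filter (¬? ∘ (b NP.≟_))) (labels-expand ps pos σ (NP.suc-injective l))))

nblocks-expand : ∀ λ′ → All (0 <ℕ_) λ′ → ∀ σ → length σ ≡ length λ′ → nblocks (expand λ′ σ) ≡ nblocks σ
nblocks-expand λ′ pos σ l = cong length (labels-expand λ′ pos σ l)

filter-above-Π : ∀ λ′ → All (0 <ℕ_) λ′ → filter (λ Λ → T? (Π λ′ ≤ᵇ Λ)) (P (sum λ′)) ≡ map (expand λ′) (P (length λ′))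
filter-above-Π λ′ pos = filter-above-Πgo λ′ pos 0 0

-- The value μ(0̂, σ) as a product over letters

count : ℕ → List ℕ → ℕ
count b x = length (filter (b NP.≟_) x)

count-self : ∀ b t → count b (b ∷ t) ≡ suc (count b t)
count-self b t = cong length (LP.filter-accept (b NP.≟_) {b} {t} refl)

count-other : ∀ b c t → b ≢ c → count b (c ∷ t) ≡ count b t
count-other b c t b≢c = cong length (LP.filter-reject (b NP.≟_) {c} {t} b≢c)

count-∉ : ∀ b t → ¬ b ∈ t → count b t ≡ 0
count-∉ b t b∉t = cong length (LP.filter-none (b NP.≟_) (tabulate λ x∈t b≡x → b∉t (subst (_∈ t) (sym b≡x) x∈t)))

count-∈ : ∀ b t → b ∈ t → ∃ λ k → count b t ≡ suc k
count-∈ b t b∈t with count b t | LP.filter-some (b NP.≟_) b∈t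
... | suc k | _ = k , refl

without : ℕ → List ℕ → List ℕ
without b = filter (¬? ∘ (b NP.≟_))

without-∉ : ∀ b D → ¬ b ∈ D → without b D ≡ D
without-∉ b D b∉D = LP.filter-all (¬? ∘ (b NP.≟_)) (tabulate λ x∈D b≡x → b∉D (subst (_∈ D) (sym b≡x) x∈D))

module _ (f : ℕ → ℤ) where

  productℤ-unique : ∀ D b → Unique D → b ∈ D → productℤ (map f D) ≡ f b * productℤ (map f (without b D))
  productℤ-unique (d ∷ D) .d (d∉D ∷ _) (here refl) = cong (λ E → f d * productℤ (map f E))
    (sym (trans (LP.filter-reject (¬? ∘ (d NP.≟_)) {d} {D} (λ d≢d → d≢d refl))
                (without-∉ d D (λ m → lookup d∉D m refl))))
  productℤ-unique (d ∷ D) b (d∉D ∷ u) (there b∈D) = begin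
      f d * productℤ (map f D)
    ≡⟨ cong (f d *_) (productℤ-unique D b u b∈D) ⟩
      f d * (f b * productℤ (map f (without b D)))
    ≡⟨ swap (f d) (f b) _ ⟩
      f b * (f d * productℤ (map f (without b D)))
    ≡⟨ cong (λ E → f b * productℤ (map f E)) (sym (LP.filter-accept (¬? ∘ (b NP.≟_)) {d} {D} (λ b≡d → lookup d∉D b∈D (sym b≡d)))) ⟩
      f b * productℤ (map f (without b (d ∷ D)))
    ∎
    where
    open ≡-Reasoning
    swap : ∀ a b c → a * (b * c) ≡ b * (a * c)
    swap = solve-∀

length-unique : ∀ D b → Unique D → b ∈ D → length D ≡ suc (length (without b D))
length-unique (d ∷ D) .d (d∉D ∷ _) (here refl) = cong (suc ∘ length)
  (sym (trans (LP.filter-reject (¬? ∘ (d NP.≟_)) {d} {D} (λ d≢d → d≢d refl)) (without-∉ d D (λ m → lookup d∉D m refl))))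
length-unique (d ∷ D) b (d∉D ∷ u) (there b∈D) = trans (cong suc (length-unique D b u b∈D))
  (cong (suc ∘ length) (sym (LP.filter-accept (¬? ∘ (b NP.≟_)) {d} {D} (λ b≡d → lookup d∉D b∈D (sym b≡d)))))

sign : ℕ → ℤ
sign k = (- + 1) ^ k

μ₀ : List ℕ → ℤ
μ₀ x = sign (length x ∸ nblocks x) * blockWeight x

blockFact : ℕ → ℤ
blockFact c = + ((c ∸ 1) !)

-- joinWeight c is the factor by which μ₀ changes when an element joins a block that already has c elements.
joinWeight : ℕ → ℤ
joinWeight zero = + 1
joinWeight (suc c) = - (+ suc c)

blockWeight-labels : ∀ x → blockWeight x ≡ productℤ (map (λ c → blockFact (count c x)) (labels x))
blockWeight-labels x = cong productℤ (sym (LP.map-∘ (labels x)))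

module _ (b : ℕ) (t : List ℕ) where

  private
    F : List ℕ
    F = without b (labels t)

    otherFactors : ℤ
    otherFactors = productℤ (map (λ c → blockFact (count c t)) F)

  blockWeight-∷ : blockWeight (b ∷ t) ≡ + (count b t !) * otherFactors
  blockWeight-∷ = trans (blockWeight-labels (b ∷ t)) (cong₂ _*_ (cong (λ n → blockFact n) (count-self b t))
    (cong productℤ (LP.map-cong-local {xs = F} (tabulate λ c∈F →
      cong blockFact (count-other _ b t (λ c≡b → proj₂ (MP.∈-filter⁻ (¬? ∘ (b NP.≟_)) {xs = labels t} c∈F) (sym c≡b)))))))

  μ₀-∷-fresh : ¬ b ∈ t → μ₀ (b ∷ t) ≡ μ₀ t
  μ₀-∷-fresh b∉t = begin
      sign (length t ∸ length F) * blockWeight (b ∷ t)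
    ≡⟨ cong₂ (λ E w → sign (length t ∸ length E) * w) F≡labels blockWeight-∷ ⟩
      sign (length t ∸ nblocks t) * (+ (count b t !) * otherFactors)
    ≡⟨ cong (λ n → sign (length t ∸ nblocks t) * (+ (n !) * otherFactors)) (count-∉ b t b∉t) ⟩
      sign (length t ∸ nblocks t) * (+ 1 * otherFactors)
    ≡⟨ cong (sign (length t ∸ nblocks t) *_) (trans (ZP.*-identityˡ otherFactors)
         (trans (cong (λ E → productℤ (map (λ c → blockFact (count c t)) E)) F≡labels) (sym (blockWeight-labels t)))) ⟩
      μ₀ t
    ∎
    where
    open ≡-Reasoning
    F≡labels : F ≡ labels t
    F≡labels = without-∉ b (labels t) (b∉t ∘ MP.∈-deduplicate⁻ NP._≟_ t)

  μ₀-∷-repeat : ∀ k → count b t ≡ suc k → b ∈ t → μ₀ (b ∷ t) ≡ joinWeight (count b t) * μ₀ t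
  μ₀-∷-repeat k count≡ b∈t = begin
      sign (suc L ∸ suc nF) * blockWeight (b ∷ t)
    ≡⟨ cong₂ (λ e w → sign e * w) (NP.+-∸-assoc 1 nF<L) blockWeight-∷ ⟩
      sign (suc (L ∸ suc nF)) * (+ (count b t !) * otherFactors)
    ≡⟨ cong (λ n → sign (suc (L ∸ suc nF)) * (+ (n !) * otherFactors)) count≡ ⟩
      (- + 1) * sign (L ∸ suc nF) * (+ (suc k N.* k !) * otherFactors)
    ≡⟨ cong (λ z → (- + 1) * sign (L ∸ suc nF) * (z * otherFactors)) (ZP.pos-* (suc k) (k !)) ⟩
      (- + 1) * sign (L ∸ suc nF) * (+ (suc k) * + (k !) * otherFactors)
    ≡⟨ rearrange (sign (L ∸ suc nF)) (+ suc k) (+ (k !)) otherFactors ⟩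
      - (+ suc k) * (sign (L ∸ suc nF) * (+ (k !) * otherFactors))
    ≡⟨ cong₂ (λ w e → w * (sign e * (+ (k !) * otherFactors))) (cong joinWeight (sym count≡)) (cong (L ∸_) (sym nblocks≡)) ⟩
      joinWeight (count b t) * (sign (L ∸ nblocks t) * (+ (k !) * otherFactors))
    ≡⟨ cong (λ w → joinWeight (count b t) * (sign (L ∸ nblocks t) * w)) (sym blockWeight≡) ⟩
      joinWeight (count b t) * μ₀ t
    ∎
    where
    open ≡-Reasoning
    L nF : ℕ
    L = length t
    nF = length F
    b∈labels : b ∈ labels t
    b∈labels = MP.∈-deduplicate⁺ NP._≟_ b∈t
    nblocks≡ : nblocks t ≡ suc nF
    nblocks≡ = length-unique (labels t) b (deduplicate-! t) b∈labels
    nF<L : suc nF ≤ℕ L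
    nF<L = subst (_≤ℕ L) nblocks≡ (LP.length-deduplicate NP._≟_ t)
    rearrange : ∀ s a b c → (- + 1) * s * (a * b * c) ≡ - a * (s * (b * c))
    rearrange = solve-∀
    blockWeight≡ : blockWeight t ≡ + (k !) * otherFactors
    blockWeight≡ = trans (blockWeight-labels t)
      (trans (productℤ-unique (λ c → blockFact (count c t)) (labels t) b (deduplicate-! t) b∈labels)
      (cong (λ n → blockFact n * otherFactors) count≡))

  μ₀-∷ : μ₀ (b ∷ t) ≡ joinWeight (count b t) * μ₀ t
  μ₀-∷ with b ∈? t
  ... | yes b∈t = let k , count≡ = count-∈ b t b∈t in μ₀-∷-repeat k count≡ b∈t
  ... | no b∉t = trans (μ₀-∷-fresh b∉t)
    (trans (sym (ZP.*-identityˡ (μ₀ t))) (cong (λ n → joinWeight n * μ₀ t) (sym (count-∉ b t b∉t))))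

productBelow : ℕ → (ℕ → ℤ) → ℤ
productBelow zero f = + 1
productBelow (suc N) f = productBelow N f * f N

productBelow-cong : ∀ N f g → (∀ b → b <ℕ N → f b ≡ g b) → productBelow N f ≡ productBelow N g
productBelow-cong zero f g h = refl
productBelow-cong (suc N) f g h = cong₂ _*_ (productBelow-cong N f g (λ b b<N → h b (NP.m≤n⇒m≤1+n b<N))) (h N NP.≤-refl)

productBelow-one : ∀ N → productBelow N (λ _ → + 1) ≡ + 1
productBelow-one zero = refl
productBelow-one (suc N) = cong (_* + 1) (productBelow-one N)

productBelow-single : ∀ N f g c α → c <ℕ N → (∀ b → b <ℕ N → b ≢ c → f b ≡ g b) → f c ≡ α * g c →
  productBelow N f ≡ α * productBelow N g
productBelow-single (suc N) f g c α c<N h fc with NP.m≤n⇒m<n∨m≡n (NP.≤-pred c<N)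
... | inj₁ c<N′ = trans (cong₂ _*_
        (productBelow-single N f g c α c<N′ (λ b b<N b≢c → h b (NP.m≤n⇒m≤1+n b<N) b≢c) fc)
        (h N NP.≤-refl (λ N≡c → NP.<-irrefl (sym N≡c) c<N′)))
      (ZP.*-assoc α _ _)
... | inj₂ refl = trans
      (cong₂ _*_ (productBelow-cong c f g (λ b b<c → h b (NP.m≤n⇒m≤1+n b<c) (λ b≡c → NP.<-irrefl b≡c b<c))) fc)
      (swap (productBelow c g) α (g c))
  where
  swap : ∀ a b c → a * (b * c) ≡ b * (a * c)
  swap = solve-∀

-- blockFactor c = (−1)^{c−1} (c−1)! for c ≥ 1
blockFactor : ℕ → ℤ
blockFactor zero = + 1
blockFactor (suc c) = joinWeight c * blockFactor c

labelProduct : ℕ → List ℕ → ℤ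
labelProduct N x = productBelow N (λ b → blockFactor (count b x))

labelProduct-∷ : ∀ N c x → c <ℕ N → labelProduct N (c ∷ x) ≡ joinWeight (count c x) * labelProduct N x
labelProduct-∷ N c x c<N = productBelow-single N _ _ c (joinWeight (count c x)) c<N
  (λ b _ b≢c → cong blockFactor (count-other b c x b≢c)) (cong blockFactor (count-self c x))

μ₀≡labelProduct : ∀ N x → Bounded N x → μ₀ x ≡ labelProduct N x
μ₀≡labelProduct N [] _ = sym (productBelow-one N)
μ₀≡labelProduct N (c ∷ x) bnd = begin
    μ₀ (c ∷ x)
  ≡⟨ μ₀-∷ c x ⟩
    joinWeight (count c x) * μ₀ x
  ≡⟨ cong (joinWeight (count c x) *_) (μ₀≡labelProduct N x (λ b m → bnd b (there m))) ⟩
    joinWeight (count c x) * labelProduct N x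
  ≡⟨ sym (labelProduct-∷ N c x (bnd c (here refl))) ⟩
    labelProduct N (c ∷ x)
  ∎
  where open ≡-Reasoning

prefixWeight : List ℕ → List ℕ → ℤ
prefixWeight acc [] = + 1
prefixWeight acc (b ∷ t) = joinWeight (count b acc) * prefixWeight (b ∷ acc) t

count-∷ : ∀ b c x → count b (c ∷ x) ≡ (if b ≡ᵇ c then suc (count b x) else count b x)
count-∷ b c x with b ≡ᵇ c
... | true  = refl
... | false = refl

count-ʳ++ : ∀ b t acc → count b (t ʳ++ acc) ≡ count b t +ℕ count b acc
count-ʳ++ b [] acc = refl
count-ʳ++ b (c ∷ t) acc = begin
    count b (t ʳ++ (c ∷ acc))
  ≡⟨ count-ʳ++ b t (c ∷ acc) ⟩
    count b t +ℕ count b (c ∷ acc)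
  ≡⟨ cong (count b t +ℕ_) (count-∷ b c acc) ⟩
    count b t +ℕ (if b ≡ᵇ c then suc (count b acc) else count b acc)
  ≡⟨ shift (b ≡ᵇ c) ⟩
    (if b ≡ᵇ c then suc (count b t) else count b t) +ℕ count b acc
  ≡⟨ cong (_+ℕ count b acc) (sym (count-∷ b c t)) ⟩
    count b (c ∷ t) +ℕ count b acc
  ∎
  where
  open ≡-Reasoning
  shift : ∀ e → count b t +ℕ (if e then suc (count b acc) else count b acc)
              ≡ (if e then suc (count b t) else count b t) +ℕ count b acc
  shift true  = NP.+-suc (count b t) (count b acc)
  shift false = refl

prefixWeight-labelProduct : ∀ N t acc → Bounded N t → Bounded N acc →
  prefixWeight acc t * labelProduct N acc ≡ labelProduct N (t ʳ++ acc)
prefixWeight-labelProduct N [] acc _ _ = ZP.*-identityˡ _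
prefixWeight-labelProduct N (c ∷ t) acc bt ba = begin
    joinWeight (count c acc) * prefixWeight (c ∷ acc) t * labelProduct N acc
  ≡⟨ rotate (joinWeight (count c acc)) (prefixWeight (c ∷ acc) t) (labelProduct N acc) ⟩
    prefixWeight (c ∷ acc) t * (joinWeight (count c acc) * labelProduct N acc)
  ≡⟨ cong (prefixWeight (c ∷ acc) t *_) (sym (labelProduct-∷ N c acc (bt c (here refl)))) ⟩
    prefixWeight (c ∷ acc) t * labelProduct N (c ∷ acc)
  ≡⟨ prefixWeight-labelProduct N t (c ∷ acc) (λ b m → bt b (there m)) bnd ⟩
    labelProduct N (t ʳ++ (c ∷ acc))
  ∎
  where
  open ≡-Reasoning
  rotate : ∀ a b c → a * b * c ≡ b * (a * c)
  rotate = solve-∀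
  bnd : Bounded N (c ∷ acc)
  bnd b (here refl) = bt c (here refl)
  bnd b (there m) = ba b m

Bounded-sum : ∀ x → Bounded (suc (sum x)) x
Bounded-sum (a ∷ x) b (here refl) = s≤s (NP.m≤m+n a (sum x))
Bounded-sum (a ∷ x) b (there m) = NP.≤-trans (Bounded-sum x b m) (s≤s (NP.m≤n+m (sum x) a))

prefixWeight≡μ₀ : ∀ x → prefixWeight [] x ≡ μ₀ x
prefixWeight≡μ₀ x = begin
    prefixWeight [] x
  ≡⟨ sym (ZP.*-identityʳ _) ⟩
    prefixWeight [] x * + 1
  ≡⟨ cong (prefixWeight [] x *_) (sym (productBelow-one N)) ⟩
    prefixWeight [] x * labelProduct N []
  ≡⟨ prefixWeight-labelProduct N x [] (Bounded-sum x) (λ b ()) ⟩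
    labelProduct N (x ʳ++ [])
  ≡⟨ productBelow-cong N _ _ (λ b _ → cong blockFactor (trans (count-ʳ++ b x []) (NP.+-identityʳ _))) ⟩
    labelProduct N x
  ≡⟨ sym (μ₀≡labelProduct N x (Bounded-sum x)) ⟩
    μ₀ x
  ∎
  where
  open ≡-Reasoning
  N : ℕ
  N = suc (sum x)

-- Summing μ₀ over the refinements of a partition

indicator : ℕ → ℕ → ℤ
indicator b a = if b ≡ᵇ a then + 1 else + 0

indicator-self : ∀ a → indicator a a ≡ + 1
indicator-self a with a ≡ᵇ a | NP.≡⇒≡ᵇ a a refl
... | true | _ = refl

indicator-other : ∀ b a → b ≢ a → indicator b a ≡ + 0
indicator-other b a b≢a with b ≡ᵇ a in e
... | false = refl
... | true  = ⊥-elim (b≢a (NP.≡ᵇ⇒≡ b a (subst T (sym e) tt)))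

count-indicator : ∀ b a x → + count b (a ∷ x) ≡ indicator b a +ᶻ + count b x
count-indicator b a x with b ≡ᵇ a | count-∷ b a x
... | true  | e = cong +_ e
... | false | e = trans (cong +_ e) (sym (ZP.+-identityˡ _))

sumℤ-indicator : ∀ c π → sumℤ (map (indicator c) π) ≡ + count c π
sumℤ-indicator c [] = refl
sumℤ-indicator c (p ∷ π) = trans (cong (indicator c p +ᶻ_) (sumℤ-indicator c π)) (sym (count-indicator c p π))

sumℤ-weighted-count : ∀ (h : ℕ → ℤ) s acc → Bounded s acc →
  sumℤ (map (λ b → h b * + count b acc) (upTo s)) ≡ sumℤ (map h acc)
sumℤ-weighted-count h s [] _ = sumℤ-zeros _ (upTo s) (λ b _ → ZP.*-zeroʳ (h b))
sumℤ-weighted-count h s (a ∷ acc) bnd = begin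
    sumℤ (map (λ b → h b * + count b (a ∷ acc)) (upTo s))
  ≡⟨ sumℤ-cong-∈ _ _ (upTo s) (λ b _ → trans (cong (h b *_) (count-indicator b a acc)) (ZP.*-distribˡ-+ (h b) (indicator b a) _)) ⟩
    sumℤ (map (λ b → h b * indicator b a +ᶻ h b * + count b acc) (upTo s))
  ≡⟨ sumℤ-+ (λ b → h b * indicator b a) (λ b → h b * + count b acc) (upTo s) ⟩
    sumℤ (map (λ b → h b * indicator b a) (upTo s)) +ᶻ sumℤ (map (λ b → h b * + count b acc) (upTo s))
  ≡⟨ cong₂ _+ᶻ_ (sumℤ-upTo-single (λ b → h b * indicator b a) s a (bnd a (here refl))
                   (λ b _ b≢a → trans (cong (h b *_) (indicator-other b a b≢a)) (ZP.*-zeroʳ (h b))))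
                (sumℤ-weighted-count h s acc (λ b m → bnd b (there m))) ⟩
    h a * indicator a a +ᶻ sumℤ (map h acc)
  ≡⟨ cong (λ i → h a * i +ᶻ sumℤ (map h acc)) (indicator-self a) ⟩
    h a * + 1 +ᶻ sumℤ (map h acc)
  ≡⟨ cong (_+ᶻ sumℤ (map h acc)) (ZP.*-identityʳ (h a)) ⟩
    sumℤ (map h (a ∷ acc))
  ∎
  where open ≡-Reasoning

compatible : ℕ → ℕ → List (ℕ × ℕ) → ℤ
compatible b c Z = if functionalᵇ ((b , c) ∷ Z) then + 1 else + 0

compatible-pair : ∀ c Z → Functional Z → ∀ a p → (a , p) ∈ Z → compatible a c Z ≡ indicator c p
compatible-pair c Z fun a p m with c NP.≟ p
... | yes refl = trans (cong (λ v → if v then + 1 else + 0) (dec-true (T? _) (T-functionalᵇ⁺ _ extend))) (sym (indicator-self c))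
  where
  extend : Functional ((a , c) ∷ Z)
  extend (here refl) (here refl) e = refl
  extend (here refl) (there m₂) refl = fun m m₂ refl
  extend (there m₁) (here refl) refl = sym (fun m m₁ refl)
  extend (there m₁) (there m₂) e = fun m₁ m₂ e
... | no c≢p = trans (cong (λ v → if v then + 1 else + 0)
                 (dec-false (T? _) (λ t → c≢p (T-functionalᵇ⁻ _ t (here refl) (there m) refl))))
                 (sym (indicator-other c p c≢p))

sumℤ-compatible : ∀ c acc π → length acc ≡ length π → Functional (zip acc π) →
  sumℤ (map (λ a → compatible a c (zip acc π)) acc) ≡ + count c π
sumℤ-compatible c acc π l fun =
  trans (sumℤ-zip _ (indicator c) acc π l (compatible-pair c (zip acc π) fun)) (sumℤ-indicator c π)

choiceWeight : ℕ → ℕ → List ℕ → List ℕ → ℤ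
choiceWeight b c acc π = if functionalᵇ ((b , c) ∷ zip acc π) then joinWeight (count b acc) else + 0

choiceWeight-used : ∀ b c acc π → b ∈ acc → choiceWeight b c acc π ≡ - (compatible b c (zip acc π) * + count b acc)
choiceWeight-used b c acc π b∈acc with count-∈ b acc b∈acc
... | k , count≡ with functionalᵇ ((b , c) ∷ zip acc π)
... | true  = trans (cong joinWeight count≡) (cong -_ (sym (trans (ZP.*-identityˡ _) (cong +_ count≡))))
... | false = cong -_ (sym (ZP.*-zeroˡ (+ count b acc)))

choiceWeight-fresh : ∀ s c acc π → Bounded s acc → Functional (zip acc π) → choiceWeight s c acc π ≡ + 1
choiceWeight-fresh s c acc π bnd fun =
  trans (cong (λ v → if v then joinWeight (count s acc) else + 0) (dec-true (T? _) (T-functionalᵇ⁺ _ extend)))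
        (cong joinWeight (count-∉ s acc (λ m → NP.<-irrefl refl (bnd s m))))
  where
  extend : Functional ((s , c) ∷ zip acc π)
  extend (here refl) (here refl) e = refl
  extend (here refl) (there m₂) refl = ⊥-elim (NP.<-irrefl refl (bnd s (zip-∈₁ acc π m₂)))
  extend (there m₁) (here refl) refl = ⊥-elim (NP.<-irrefl refl (bnd s (zip-∈₁ acc π m₁)))
  extend (there m₁) (there m₂) e = fun m₁ m₂ e

-- A fresh label contributes 1, and an old block compatible with c contributes minus its size; the old
-- blocks compatible with c partition the earlier occurrences of c.
sumℤ-choiceWeight : ∀ s c acc π → length acc ≡ length π → Covers s acc → Bounded s acc → Functional (zip acc π) →
  sumℤ (map (λ b → choiceWeight b c acc π) (upTo (suc s))) ≡ + 1 - + count c π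
sumℤ-choiceWeight s c acc π l cov bnd fun = begin
    sumℤ (map (λ b → choiceWeight b c acc π) (upTo (suc s)))
  ≡⟨ sumℤ-upTo-suc (λ b → choiceWeight b c acc π) s ⟩
    sumℤ (map (λ b → choiceWeight b c acc π) (upTo s)) +ᶻ choiceWeight s c acc π
  ≡⟨ cong₂ _+ᶻ_ (sumℤ-cong-∈ _ _ (upTo s) (λ b m → choiceWeight-used b c acc π (cov b (MP.∈-upTo⁻ m))))
                (choiceWeight-fresh s c acc π bnd fun) ⟩
    sumℤ (map (λ b → - (compatible b c (zip acc π) * + count b acc)) (upTo s)) +ᶻ + 1
  ≡⟨ cong (_+ᶻ + 1) (sumℤ-neg (λ b → compatible b c (zip acc π) * + count b acc) (upTo s)) ⟩
    - sumℤ (map (λ b → compatible b c (zip acc π) * + count b acc) (upTo s)) +ᶻ + 1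
  ≡⟨ cong (λ v → - v +ᶻ + 1) (trans (sumℤ-weighted-count (λ b → compatible b c (zip acc π)) s acc bnd)
                                     (sumℤ-compatible c acc π l fun)) ⟩
    - + count c π +ᶻ + 1
  ≡⟨ ZP.+-comm (- + count c π) (+ 1) ⟩
    + 1 - + count c π
  ∎
  where open ≡-Reasoning

coarseProduct : List ℕ → List ℕ → ℤ
coarseProduct π [] = + 1
coarseProduct π (c ∷ τ) = (+ 1 - + count c π) * coarseProduct (c ∷ π) τ

refinesᵇ : List ℕ → List ℕ → List ℕ → List ℕ → Bool
refinesᵇ acc π τ t = functionalᵇ (zip acc π ++ zip t τ)

refinesᵇ-shift : ∀ acc π b c τ t → refinesᵇ acc π (c ∷ τ) (b ∷ t) ≡ refinesᵇ (b ∷ acc) (c ∷ π) τ t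
refinesᵇ-shift acc π b c τ t = functionalᵇ-ext _ _
  (Functional-anti (zip-shift acc π t τ b c)) (Functional-anti (zip-unshift acc π t τ b c))

filter-refinesᵇ-incompatible : ∀ acc π b c τ G → functionalᵇ ((b , c) ∷ zip acc π) ≡ false →
  filter (T? ∘ refinesᵇ acc π (c ∷ τ)) (map (b ∷_) G) ≡ []
filter-refinesᵇ-incompatible acc π b c τ G incompatible =
  trans (filter-map (T? ∘ refinesᵇ acc π (c ∷ τ)) (b ∷_) G) (cong (map (b ∷_)) (filter-none-∈ _ G (λ t _ →
    dec-false (T? _) λ r → subst T incompatible
      (T-functionalᵇ⁺ _ (Functional-anti head (T-functionalᵇ⁻ (zip acc π ++ zip (b ∷ t) (c ∷ τ)) r))))))
  where
  head : ∀ {t} → (b , c) ∷ zip acc π ⊆ zip acc π ++ zip (b ∷ t) (c ∷ τ)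
  head (here e) = MP.∈-++⁺ʳ (zip acc π) (here e)
  head (there m) = MP.∈-++⁺ˡ m

sumℤ-prefixWeight-branch : ∀ acc π b c τ G →
  sumℤ (map (prefixWeight acc) (filter (T? ∘ refinesᵇ acc π (c ∷ τ)) (map (b ∷_) G)))
  ≡ joinWeight (count b acc) * sumℤ (map (prefixWeight (b ∷ acc)) (filter (T? ∘ refinesᵇ (b ∷ acc) (c ∷ π) τ) G))
sumℤ-prefixWeight-branch acc π b c τ G = begin
    sumℤ (map (prefixWeight acc) (filter Refines? (map (b ∷_) G)))
  ≡⟨ cong (sumℤ ∘ map (prefixWeight acc)) (filter-map Refines? (b ∷_) G) ⟩
    sumℤ (map (prefixWeight acc) (map (b ∷_) (filter (Refines? ∘ (b ∷_)) G)))
  ≡⟨ cong sumℤ (sym (LP.map-∘ (filter (Refines? ∘ (b ∷_)) G))) ⟩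
    sumℤ (map (λ t → joinWeight (count b acc) * prefixWeight (b ∷ acc) t) (filter (Refines? ∘ (b ∷_)) G))
  ≡⟨ sumℤ-scale (joinWeight (count b acc)) (prefixWeight (b ∷ acc)) (filter (Refines? ∘ (b ∷_)) G) ⟩
    joinWeight (count b acc) * sumℤ (map (prefixWeight (b ∷ acc)) (filter (Refines? ∘ (b ∷_)) G))
  ≡⟨ cong (λ Y → joinWeight (count b acc) * sumℤ (map (prefixWeight (b ∷ acc)) Y))
       (filter-cong-∈ _ (T? ∘ refinesᵇ (b ∷ acc) (c ∷ π) τ) G (λ t _ → refinesᵇ-shift acc π b c τ t)) ⟩
    joinWeight (count b acc) * sumℤ (map (prefixWeight (b ∷ acc)) (filter (T? ∘ refinesᵇ (b ∷ acc) (c ∷ π) τ) G))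
  ∎
  where
  open ≡-Reasoning
  Refines? : Decidable (T ∘ refinesᵇ acc π (c ∷ τ))
  Refines? = T? ∘ refinesᵇ acc π (c ∷ τ)

-- Summing over the label chosen for each letter in turn, the letter c contributes the factor
-- 1 - count c π whatever was chosen before (sumℤ-choiceWeight).
sumℤ-prefixWeight-refinements : ∀ τ s acc π → length acc ≡ length π → Covers s acc → Bounded s acc →
  Functional (zip acc π) →
  sumℤ (map (prefixWeight acc) (filter (T? ∘ refinesᵇ acc π τ) (gen (length τ) s))) ≡ coarseProduct π τ
sumℤ-prefixWeight-refinements [] s acc π l cov bnd fun
  rewrite dec-true (T? (refinesᵇ acc π [] [])) (T-functionalᵇ⁺ (zip acc π ++ [])
            (Functional-anti (subst (_ ∈_) (LP.++-identityʳ (zip acc π))) fun)) = refl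
sumℤ-prefixWeight-refinements (c ∷ τ) s acc π l cov bnd fun = begin
    sumℤ (map (prefixWeight acc) (filter Refines? (concatMap Branch (upTo (suc s)))))
  ≡⟨ cong (sumℤ ∘ map (prefixWeight acc)) (filter-concatMap Refines? Branch (upTo (suc s))) ⟩
    sumℤ (map (prefixWeight acc) (concatMap (filter Refines? ∘ Branch) (upTo (suc s))))
  ≡⟨ sumℤ-concatMap (prefixWeight acc) (filter Refines? ∘ Branch) (upTo (suc s)) ⟩
    sumℤ (map (λ b → sumℤ (map (prefixWeight acc) (filter Refines? (Branch b)))) (upTo (suc s)))
  ≡⟨ sumℤ-cong-∈ _ _ (upTo (suc s)) (λ b m → branch b (NP.≤-pred (MP.∈-upTo⁻ m))) ⟩
    sumℤ (map (λ b → rest * choiceWeight b c acc π) (upTo (suc s)))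
  ≡⟨ sumℤ-scale rest (λ b → choiceWeight b c acc π) (upTo (suc s)) ⟩
    rest * sumℤ (map (λ b → choiceWeight b c acc π) (upTo (suc s)))
  ≡⟨ cong (rest *_) (sumℤ-choiceWeight s c acc π l cov bnd fun) ⟩
    rest * (+ 1 - + count c π)
  ≡⟨ ZP.*-comm rest _ ⟩
    coarseProduct π (c ∷ τ)
  ∎
  where
  open ≡-Reasoning
  rest : ℤ
  rest = coarseProduct (c ∷ π) τ
  Refines? : Decidable (T ∘ refinesᵇ acc π (c ∷ τ))
  Refines? = T? ∘ refinesᵇ acc π (c ∷ τ)
  Branch : ℕ → List (List ℕ)
  Branch b = map (b ∷_) (gen (length τ) (nextCount b s))
  branch : ∀ b → b ≤ℕ s → sumℤ (map (prefixWeight acc) (filter Refines? (Branch b))) ≡ rest * choiceWeight b c acc π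
  branch b b≤s with functionalᵇ ((b , c) ∷ zip acc π) in compatible?
  ... | true = begin
      sumℤ (map (prefixWeight acc) (filter Refines? (Branch b)))
    ≡⟨ sumℤ-prefixWeight-branch acc π b c τ (gen (length τ) (nextCount b s)) ⟩
      joinWeight (count b acc) * sumℤ (map (prefixWeight (b ∷ acc))
        (filter (T? ∘ refinesᵇ (b ∷ acc) (c ∷ π) τ) (gen (length τ) (nextCount b s))))
    ≡⟨ cong (joinWeight (count b acc) *_) (sumℤ-prefixWeight-refinements τ (nextCount b s) (b ∷ acc) (c ∷ π)
         (cong suc l) (Covers-∷ s acc b cov b≤s) (Bounded-∷ s acc b bnd b≤s)
         (T-functionalᵇ⁻ _ (Equivalence.from T-≡ compatible?))) ⟩
      joinWeight (count b acc) * rest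
    ≡⟨ ZP.*-comm _ rest ⟩
      rest * joinWeight (count b acc)
    ∎
  ... | false = begin
      sumℤ (map (prefixWeight acc) (filter Refines? (Branch b)))
    ≡⟨ cong (sumℤ ∘ map (prefixWeight acc))
         (filter-refinesᵇ-incompatible acc π b c τ (gen (length τ) (nextCount b s)) compatible?) ⟩
      + 0
    ≡⟨ sym (ZP.*-zeroʳ rest) ⟩
      rest * + 0
    ∎

-- The Möbius function from 0̂ and from Π(λ)

-- A restricted growth string other than s, s+1, … repeats a label, and at the first repetition the
-- factor of coarseProduct is 1 - 1.
coarseProduct-≡0 : ∀ σ s π → RGS s σ → (∀ b → b <ℕ s → count b π ≡ 1) → (∀ b → s ≤ℕ b → count b π ≡ 0) →
  σ ≢ ascending s (length σ) → coarseProduct π σ ≡ + 0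
coarseProduct-≡0 [] s π _ _ _ σ≢ = ⊥-elim (σ≢ refl)
coarseProduct-≡0 (b ∷ σ) s π (b≤s ∷ rσ) once none σ≢ with NP.m≤n⇒m<n∨m≡n b≤s
... | inj₁ b<s rewrite once b b<s = refl
... | inj₂ refl rewrite none b NP.≤-refl =
  trans (ZP.*-identityˡ _) (coarseProduct-≡0 σ (nextCount b b) (b ∷ π) rσ once′ none′ σ≢′)
  where
  once′ : ∀ b′ → b′ <ℕ nextCount b b → count b′ (b ∷ π) ≡ 1
  once′ b′ b′< with b′ NP.≟ b
  ... | yes refl = trans (count-self b π) (cong suc (none b NP.≤-refl))
  ... | no b′≢b = trans (count-other b′ b π b′≢b)
                    (once b′ (NP.≤∧≢⇒< (NP.≤-pred (subst (b′ <ℕ_) (nextCount-fresh b) b′<)) b′≢b))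
  none′ : ∀ b′ → nextCount b b ≤ℕ b′ → count b′ (b ∷ π) ≡ 0
  none′ b′ b< = trans (count-other b′ b π (λ b′≡b → NP.<-irrefl (sym b′≡b) (subst (_≤ℕ b′) (nextCount-fresh b) b<)))
                  (none b′ (NP.<⇒≤ (subst (_≤ℕ b′) (nextCount-fresh b) b<)))
  σ≢′ : σ ≢ ascending (nextCount b b) (length σ)
  σ≢′ e = σ≢ (cong (b ∷_) (trans e (cong (λ i → ascending i (length σ)) (nextCount-fresh b))))

ascending-≥ : ∀ i m {c} → c ∈ ascending i m → i ≤ℕ c
ascending-≥ i (suc m) (here refl) = NP.≤-refl
ascending-≥ i (suc m) (there c∈) = NP.<⇒≤ (ascending-≥ (suc i) m c∈)

Functional-ascending : ∀ i m z → Functional (zip (ascending i m) z)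
Functional-ascending i (suc m) (b ∷ z) (here refl) (here refl) _ = refl
Functional-ascending i (suc m) (b ∷ z) (here refl) (there m₂) refl =
  ⊥-elim (NP.<-irrefl refl (ascending-≥ (suc i) m (zip-∈₁ (ascending (suc i) m) z m₂)))
Functional-ascending i (suc m) (b ∷ z) (there m₁) (here refl) refl =
  ⊥-elim (NP.<-irrefl refl (ascending-≥ (suc i) m (zip-∈₁ (ascending (suc i) m) z m₁)))
Functional-ascending i (suc m) (b ∷ z) (there m₁) (there m₂) e = Functional-ascending (suc i) m z m₁ m₂ e

ascending-≤ᵇ : ∀ m z → (ascending 0 m ≤ᵇ z) ≡ true
ascending-≤ᵇ m z = dec-true (T? _) (Functional⇒≤ᵇ (ascending 0 m) z (Functional-ascending 0 m z))

prefixWeight-ascending : ∀ acc s r → Bounded s acc → prefixWeight acc (ascending s r) ≡ + 1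
prefixWeight-ascending acc s zero _ = refl
prefixWeight-ascending acc s (suc r) bnd rewrite count-∉ s acc (λ m → NP.<-irrefl refl (bnd s m)) =
  trans (ZP.*-identityˡ _) (prefixWeight-ascending (s ∷ acc) (suc s) r bnd′)
  where
  bnd′ : Bounded (suc s) (s ∷ acc)
  bnd′ b (here refl) = NP.≤-refl
  bnd′ b (there m) = NP.m≤n⇒m≤1+n (bnd b m)

μ₀-ascending : ∀ m → μ₀ (ascending 0 m) ≡ + 1
μ₀-ascending m = trans (sym (prefixWeight≡μ₀ (ascending 0 m))) (prefixWeight-ascending [] 0 m (λ b ()))

sumℤ-μ₀-below : ∀ m σ → σ ∈ P m → σ ≢ ascending 0 m → sumℤ (map μ₀ (filter (λ z → T? (z ≤ᵇ σ)) (P m))) ≡ + 0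
sumℤ-μ₀-below m σ σ∈ σ≢ = begin
    sumℤ (map μ₀ (filter (λ z → T? (z ≤ᵇ σ)) (P m)))
  ≡⟨ sumℤ-cong-∈ μ₀ (prefixWeight []) (filter (λ z → T? (z ≤ᵇ σ)) (P m)) (λ z _ → sym (prefixWeight≡μ₀ z)) ⟩
    sumℤ (map (prefixWeight []) (filter (λ z → T? (z ≤ᵇ σ)) (gen m 0)))
  ≡⟨ cong (λ r → sumℤ (map (prefixWeight []) (filter (λ z → T? (z ≤ᵇ σ)) (gen r 0)))) (sym length≡) ⟩
    sumℤ (map (prefixWeight []) (filter (λ z → T? (z ≤ᵇ σ)) (gen (length σ) 0)))
  ≡⟨ cong (sumℤ ∘ map (prefixWeight [])) (filter-cong-∈ _ _ (gen (length σ) 0)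
       (λ z _ → T-ext (T-functionalᵇ⁺ (zip z σ) ∘ ≤ᵇ⇒Functional z σ)
                      (Functional⇒≤ᵇ z σ ∘ T-functionalᵇ⁻ (zip z σ)))) ⟩
    sumℤ (map (prefixWeight []) (filter (T? ∘ refinesᵇ [] [] σ) (gen (length σ) 0)))
  ≡⟨ sumℤ-prefixWeight-refinements σ 0 [] [] refl (λ b ()) (λ b ()) (λ ()) ⟩
    coarseProduct [] σ
  ≡⟨ coarseProduct-≡0 σ 0 [] (∈-gen⇒RGS m 0 σ∈) (λ b ()) (λ b _ → refl)
       (λ e → σ≢ (trans e (cong (ascending 0) length≡))) ⟩
    + 0
  ∎
  where
  open ≡-Reasoning
  length≡ : length σ ≡ m
  length≡ = ∈-gen⇒length m 0 σ∈

filter-strictly-between : ∀ m σ →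
  filter (λ z → T? ((ascending 0 m ≤ᵇ z) ∧ ((z ≤ᵇ σ) ∧ not (z == σ)))) (P m)
  ≡ filter (λ z → T? (not (z == σ))) (filter (λ z → T? (z ≤ᵇ σ)) (P m))
filter-strictly-between m σ = begin
    filter (λ z → T? ((ascending 0 m ≤ᵇ z) ∧ ((z ≤ᵇ σ) ∧ not (z == σ)))) (P m)
  ≡⟨ filter-∧ (ascending 0 m ≤ᵇ_) (λ z → (z ≤ᵇ σ) ∧ not (z == σ)) (P m) ⟩
    filter (λ z → T? ((z ≤ᵇ σ) ∧ not (z == σ))) (filter (λ z → T? (ascending 0 m ≤ᵇ z)) (P m))
  ≡⟨ cong (filter (λ z → T? ((z ≤ᵇ σ) ∧ not (z == σ))))
       (filter-all-∈ (λ z → T? (ascending 0 m ≤ᵇ z)) (P m) (λ z _ → ascending-≤ᵇ m z)) ⟩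
    filter (λ z → T? ((z ≤ᵇ σ) ∧ not (z == σ))) (P m)
  ≡⟨ filter-∧ (_≤ᵇ σ) (λ z → not (z == σ)) (P m) ⟩
    filter (λ z → T? (not (z == σ))) (filter (λ z → T? (z ≤ᵇ σ)) (P m))
  ∎
  where open ≡-Reasoning

sumℤ-μ₀-strictly-below : ∀ m σ → σ ∈ P m → σ ≢ ascending 0 m →
  sumℤ (map μ₀ (filter (λ z → T? (not (z == σ))) (filter (λ z → T? (z ≤ᵇ σ)) (P m)))) ≡ - μ₀ σ
sumℤ-μ₀-strictly-below m σ σ∈ σ≢ = begin
    sumℤ (map μ₀ W)
  ≡⟨ cancel (μ₀ σ) (sumℤ (map μ₀ W)) ⟩
    - μ₀ σ +ᶻ (μ₀ σ +ᶻ + 0 +ᶻ sumℤ (map μ₀ W))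
  ≡⟨ cong (λ E → - μ₀ σ +ᶻ (sumℤ (map μ₀ E) +ᶻ sumℤ (map μ₀ W))) (sym σ-only) ⟩
    - μ₀ σ +ᶻ (sumℤ (map μ₀ (filter Eq? V)) +ᶻ sumℤ (map μ₀ W))
  ≡⟨ cong (- μ₀ σ +ᶻ_) (sym split) ⟩
    - μ₀ σ +ᶻ sumℤ (map μ₀ V)
  ≡⟨ cong (- μ₀ σ +ᶻ_) (sumℤ-μ₀-below m σ σ∈ σ≢) ⟩
    - μ₀ σ +ᶻ + 0
  ≡⟨ ZP.+-identityʳ _ ⟩
    - μ₀ σ
  ∎
  where
  open ≡-Reasoning
  Eq? : Decidable (λ z → T (z == σ))
  Eq? z = T? (z == σ)
  V W : List (List ℕ)
  V = filter (λ z → T? (z ≤ᵇ σ)) (P m)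
  W = filter (λ z → T? (not (z == σ))) V
  cancel : ∀ a w → w ≡ - a +ᶻ (a +ᶻ + 0 +ᶻ w)
  cancel = solve-∀
  σ-only : filter Eq? V ≡ σ ∷ []
  σ-only = trans (filter-comm Eq? (λ z → T? (z ≤ᵇ σ)) (P m))
    (trans (cong (filter (λ z → T? (z ≤ᵇ σ))) (gen-occurs-once m 0 σ σ∈))
           (LP.filter-accept (λ z → T? (z ≤ᵇ σ)) {σ} {[]} (Equivalence.from T-≡ (≤ᵇ-refl σ))))
  split : sumℤ (map μ₀ V) ≡ sumℤ (map μ₀ (filter Eq? V)) +ᶻ sumℤ (map μ₀ W)
  split = trans (sumℤ-split μ₀ Eq? V) (cong (sumℤ (map μ₀ (filter Eq? V)) +ᶻ_)
    (cong (sumℤ ∘ map μ₀) (filter-cong-∈ (¬? ∘ Eq?) (λ z → T? (not (z == σ))) V (λ z _ → refl))))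

-- The fuel suffices because a strict refinement z < σ has more blocks, and finalCount counts them.
μ-fuel-bottom : ∀ m f σ → σ ∈ P m → m ∸ finalCount 0 σ <ℕ f → μ-fuel f (P m) (ascending 0 m) σ ≡ μ₀ σ
μ-fuel-bottom m (suc f) σ σ∈ fuel with ascending 0 m == σ in bottom?
... | true = trans (sym (μ₀-ascending m)) (cong μ₀ (==⇒≡ (ascending 0 m) σ bottom?))
... | false rewrite ascending-≤ᵇ m σ = begin
    - sumℤ (map (μ-fuel f (P m) (ascending 0 m))
        (filter (λ z → T? ((ascending 0 m ≤ᵇ z) ∧ ((z ≤ᵇ σ) ∧ not (z == σ)))) (P m)))
  ≡⟨ cong (λ Z → - sumℤ (map (μ-fuel f (P m) (ascending 0 m)) Z)) (filter-strictly-between m σ) ⟩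
    - sumℤ (map (μ-fuel f (P m) (ascending 0 m)) W)
  ≡⟨ cong -_ (sumℤ-cong-∈ _ _ W below) ⟩
    - sumℤ (map μ₀ W)
  ≡⟨ cong -_ (sumℤ-μ₀-strictly-below m σ σ∈ (==-false⇒≢ (ascending 0 m) σ bottom? ∘ sym)) ⟩
    - (- μ₀ σ)
  ≡⟨ ZP.neg-involutive (μ₀ σ) ⟩
    μ₀ σ
  ∎
  where
  open ≡-Reasoning
  V W : List (List ℕ)
  V = filter (λ z → T? (z ≤ᵇ σ)) (P m)
  W = filter (λ z → T? (not (z == σ))) V
  below : ∀ z → z ∈ W → μ-fuel f (P m) (ascending 0 m) z ≡ μ₀ z
  below z z∈W = μ-fuel-bottom m f z z∈P (NP.<-≤-trans (NP.∸-monoʳ-< more-blocks at-most-m) (NP.≤-pred fuel))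
    where
    z∈V : z ∈ V
    z∈V = proj₁ (MP.∈-filter⁻ (λ z → T? (not (z == σ))) {xs = V} z∈W)
    z≢σ : z ≢ σ
    z≢σ z≡σ = subst (T ∘ not) (trans (cong (_== σ) z≡σ) (==-refl σ))
                (proj₂ (MP.∈-filter⁻ (λ z → T? (not (z == σ))) {xs = V} z∈W))
    z∈P : z ∈ P m
    z∈P = proj₁ (MP.∈-filter⁻ (λ z → T? (z ≤ᵇ σ)) {xs = P m} z∈V)
    z≤σ : T (z ≤ᵇ σ)
    z≤σ = proj₂ (MP.∈-filter⁻ (λ z → T? (z ≤ᵇ σ)) {xs = P m} z∈V)
    more-blocks : finalCount 0 σ <ℕ finalCount 0 z
    more-blocks = finalCount-strict z σ [] 0 (trans (∈-gen⇒length m 0 z∈P) (sym (∈-gen⇒length m 0 σ∈)))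
      (∈-gen⇒RGS m 0 z∈P) (∈-gen⇒RGS m 0 σ∈) (λ b ()) (λ b ()) (≤ᵇ⇒Functional z σ z≤σ) z≢σ
    at-most-m : finalCount 0 z ≤ℕ m
    at-most-m = subst (finalCount 0 z ≤ℕ_) (∈-gen⇒length m 0 z∈P) (finalCount-≤ 0 z)

filter-above-expand-ascending : ∀ λ′ → All (0 <ℕ_) λ′ →
  filter (λ z → T? (expand λ′ (ascending 0 (length λ′)) ≤ᵇ z)) (P (sum λ′)) ≡ map (expand λ′) (P (length λ′))
filter-above-expand-ascending λ′ pos = trans
  (filter-cong-∈ _ _ (P (sum λ′)) (λ z _ → cong (_≤ᵇ z) (sym (Πgo≡expand-ascending 0 λ′))))
  (filter-above-Π λ′ pos)

filter-between-expand : ∀ λ′ → All (0 <ℕ_) λ′ → ∀ σ → length σ ≡ length λ′ →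
  let ι = ascending 0 (length λ′) in
  filter (λ z → T? ((expand λ′ ι ≤ᵇ z) ∧ ((z ≤ᵇ expand λ′ σ) ∧ not (z == expand λ′ σ)))) (P (sum λ′))
  ≡ map (expand λ′) (filter (λ z → T? ((ι ≤ᵇ z) ∧ ((z ≤ᵇ σ) ∧ not (z == σ)))) (P (length λ′)))
filter-between-expand λ′ pos σ l = begin
    filter (λ z → T? ((expand λ′ ι ≤ᵇ z) ∧ Between (expand λ′ σ) z)) (P (sum λ′))
  ≡⟨ filter-∧ (expand λ′ ι ≤ᵇ_) (Between (expand λ′ σ)) (P (sum λ′)) ⟩
    filter (T? ∘ Between (expand λ′ σ)) (filter (λ z → T? (expand λ′ ι ≤ᵇ z)) (P (sum λ′)))
  ≡⟨ cong (filter (T? ∘ Between (expand λ′ σ))) (filter-above-expand-ascending λ′ pos) ⟩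
    filter (T? ∘ Between (expand λ′ σ)) (map (expand λ′) (P m))
  ≡⟨ filter-map (T? ∘ Between (expand λ′ σ)) (expand λ′) (P m) ⟩
    map (expand λ′) (filter (T? ∘ Between (expand λ′ σ) ∘ expand λ′) (P m))
  ≡⟨ cong (map (expand λ′)) (filter-cong-∈ _ _ (P m) (λ z z∈ → cong₂ _∧_
       (expand-≤ᵇ λ′ pos z σ (∈-gen⇒length m 0 z∈) l) (cong not (expand-== λ′ pos z σ (∈-gen⇒length m 0 z∈) l)))) ⟩
    map (expand λ′) (filter (T? ∘ Between σ) (P m))
  ≡⟨ cong (map (expand λ′) ∘ filter (T? ∘ Between σ))
       (sym (filter-all-∈ (λ z → T? (ι ≤ᵇ z)) (P m) (λ z _ → ascending-≤ᵇ m z))) ⟩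
    map (expand λ′) (filter (T? ∘ Between σ) (filter (λ z → T? (ι ≤ᵇ z)) (P m)))
  ≡⟨ cong (map (expand λ′)) (sym (filter-∧ (ι ≤ᵇ_) (Between σ) (P m))) ⟩
    map (expand λ′) (filter (λ z → T? ((ι ≤ᵇ z) ∧ Between σ z)) (P m))
  ∎
  where
  open ≡-Reasoning
  m : ℕ
  m = length λ′
  ι : List ℕ
  ι = ascending 0 m
  Between : List ℕ → List ℕ → Bool
  Between y z = (z ≤ᵇ y) ∧ not (z == y)

-- The interval [Π(λ), 1̂] of P[n] is isomorphic to P[ℓ(λ)], so the Möbius recursion computes the same values.
μ-fuel-expand : ∀ λ′ → All (0 <ℕ_) λ′ → ∀ f σ → length σ ≡ length λ′ →
  μ-fuel f (P (sum λ′)) (expand λ′ (ascending 0 (length λ′))) (expand λ′ σ)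
  ≡ μ-fuel f (P (length λ′)) (ascending 0 (length λ′)) σ
μ-fuel-expand λ′ pos zero σ l = refl
μ-fuel-expand λ′ pos (suc f) σ l
  rewrite expand-== λ′ pos (ascending 0 (length λ′)) σ (length-ascending 0 (length λ′)) l
        | expand-≤ᵇ λ′ pos (ascending 0 (length λ′)) σ (length-ascending 0 (length λ′)) l
  with ascending 0 (length λ′) == σ | ascending 0 (length λ′) ≤ᵇ σ
... | true  | _     = refl
... | false | false = refl
... | false | true  = cong -_ (begin
    sumℤ (map (μ-fuel f (P (sum λ′)) (expand λ′ ι))
      (filter (λ z → T? ((expand λ′ ι ≤ᵇ z) ∧ ((z ≤ᵇ expand λ′ σ) ∧ not (z == expand λ′ σ)))) (P (sum λ′))))
  ≡⟨ cong (sumℤ ∘ map (μ-fuel f (P (sum λ′)) (expand λ′ ι))) (filter-between-expand λ′ pos σ l) ⟩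
    sumℤ (map (μ-fuel f (P (sum λ′)) (expand λ′ ι)) (map (expand λ′) Between))
  ≡⟨ cong sumℤ (sym (LP.map-∘ Between)) ⟩
    sumℤ (map (μ-fuel f (P (sum λ′)) (expand λ′ ι) ∘ expand λ′) Between)
  ≡⟨ sumℤ-cong-∈ _ _ Between (λ z z∈ → μ-fuel-expand λ′ pos f z (∈-gen⇒length (length λ′) 0
       (proj₁ (MP.∈-filter⁻ (λ z → T? ((ι ≤ᵇ z) ∧ ((z ≤ᵇ σ) ∧ not (z == σ)))) {xs = P (length λ′)} z∈)))) ⟩
    sumℤ (map (μ-fuel f (P (length λ′)) ι) Between)
  ∎)
  where
  open ≡-Reasoning
  ι : List ℕ
  ι = ascending 0 (length λ′)
  Between : List (List ℕ)
  Between = filter (λ z → T? ((ι ≤ᵇ z) ∧ ((z ≤ᵇ σ) ∧ not (z == σ)))) (P (length λ′))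

-- Counting blocks and signs

length≤sum : ∀ λ′ → All (0 <ℕ_) λ′ → length λ′ ≤ℕ sum λ′
length≤sum [] [] = z≤n
length≤sum (p ∷ ps) (p>0 ∷ pos) = NP.+-mono-≤ p>0 (length≤sum ps pos)

lhsIndex≡map-expand : ∀ λ′ → All (0 <ℕ_) λ′ → ∀ d →
  lhsIndex (sum λ′) λ′ d ≡ map (expand λ′) (rhsIndex (length λ′) (sum λ′) d)
lhsIndex≡map-expand λ′ pos d = begin
    filter (λ Λ → T? (Π λ′ ≤ᵇ Λ)) (filter Blocks? (P (sum λ′)))
  ≡⟨ filter-comm (λ Λ → T? (Π λ′ ≤ᵇ Λ)) Blocks? (P (sum λ′)) ⟩
    filter Blocks? (filter (λ Λ → T? (Π λ′ ≤ᵇ Λ)) (P (sum λ′)))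
  ≡⟨ cong (filter Blocks?) (filter-above-Π λ′ pos) ⟩
    filter Blocks? (map (expand λ′) (P (length λ′)))
  ≡⟨ filter-map Blocks? (expand λ′) (P (length λ′)) ⟩
    map (expand λ′) (filter (Blocks? ∘ expand λ′) (P (length λ′)))
  ≡⟨ cong (map (expand λ′)) (filter-cong-∈ _ Blocks? (P (length λ′)) (λ σ σ∈ →
       cong (λ b → does (+ b Z.≟ (+ sum λ′ - d))) (nblocks-expand λ′ pos σ (∈-gen⇒length (length λ′) 0 σ∈)))) ⟩
    map (expand λ′) (rhsIndex (length λ′) (sum λ′) d)
  ∎
  where
  open ≡-Reasoning
  Blocks? : Decidable (λ Λ → + nblocks Λ ≡ + sum λ′ - d)
  Blocks? Λ = + nblocks Λ Z.≟ (+ sum λ′ - d)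

μ-Π-expand : ∀ λ′ → All (0 <ℕ_) λ′ → ∀ σ → σ ∈ P (length λ′) → μ (sum λ′) (Π λ′) (expand λ′ σ) ≡ μ₀ σ
μ-Π-expand λ′ pos σ σ∈ = begin
    μ-fuel (suc (sum λ′)) (P (sum λ′)) (Π λ′) (expand λ′ σ)
  ≡⟨ cong (λ x → μ-fuel (suc (sum λ′)) (P (sum λ′)) x (expand λ′ σ)) (Πgo≡expand-ascending 0 λ′) ⟩
    μ-fuel (suc (sum λ′)) (P (sum λ′)) (expand λ′ (ascending 0 (length λ′))) (expand λ′ σ)
  ≡⟨ μ-fuel-expand λ′ pos (suc (sum λ′)) σ (∈-gen⇒length (length λ′) 0 σ∈) ⟩
    μ-fuel (suc (sum λ′)) (P (length λ′)) (ascending 0 (length λ′)) σ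
  ≡⟨ μ-fuel-bottom (length λ′) (suc (sum λ′)) σ σ∈
       (s≤s (NP.≤-trans (NP.m∸n≤m (length λ′) (finalCount 0 σ)) (length≤sum λ′ pos))) ⟩
    μ₀ σ
  ∎
  where open ≡-Reasoning

module _ (m k n : ℕ) (d : ℤ) (m+k≡n : m +ℕ k ≡ n) where

  rhsIndex⁻ : ∀ {σ} → σ ∈ rhsIndex m n d → σ ∈ P m × + nblocks σ ≡ + n - d
  rhsIndex⁻ = MP.∈-filter⁻ (λ Λ → + nblocks Λ Z.≟ (+ n - d)) {xs = P m}

  rhsIndex-nblocks≤ : ∀ {σ} → σ ∈ rhsIndex m n d → nblocks σ ≤ℕ m
  rhsIndex-nblocks≤ {σ} σ∈ =
    subst (nblocks σ ≤ℕ_) (∈-gen⇒length m 0 (proj₁ (rhsIndex⁻ σ∈))) (LP.length-deduplicate NP._≟_ σ)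

  n∸nblocks : ∀ {σ} → σ ∈ rhsIndex m n d → n ∸ nblocks σ ≡ (m ∸ nblocks σ) +ℕ k
  n∸nblocks {σ} σ∈ = trans (cong (_∸ nblocks σ) (sym m+k≡n)) (NP.+-∸-comm k (rhsIndex-nblocks≤ σ∈))

  rhsIndex-d : ∀ {σ} → σ ∈ rhsIndex m n d → d ≡ + (n ∸ nblocks σ)
  rhsIndex-d {σ} σ∈ = begin
      d
    ≡⟨ flip d (+ n) ⟩
      + n - (+ n - d)
    ≡⟨ cong (λ x → + n - x) (sym (proj₂ (rhsIndex⁻ σ∈))) ⟩
      + n - + nblocks σ
    ≡⟨ ZP.m-n≡m⊖n n (nblocks σ) ⟩
      n Z.⊖ nblocks σ
    ≡⟨ ZP.⊖-≥ (NP.≤-trans (rhsIndex-nblocks≤ σ∈) (subst (m ≤ℕ_) m+k≡n (NP.m≤m+n m k))) ⟩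
      + (n ∸ nblocks σ)
    ∎
    where
    open ≡-Reasoning
    flip : ∀ d n → d ≡ n - (n - d)
    flip = solve-∀

  rhsIndex-exponent : ∀ {σ} → σ ∈ rhsIndex m n d → ∣ d - + k ∣ ≡ length σ ∸ nblocks σ
  rhsIndex-exponent {σ} σ∈ = begin
      ∣ d - + k ∣
    ≡⟨ cong (λ x → ∣ x - + k ∣) (rhsIndex-d σ∈) ⟩
      ∣ + (n ∸ nblocks σ) - + k ∣
    ≡⟨ cong ∣_∣ (ZP.m-n≡m⊖n (n ∸ nblocks σ) k) ⟩
      ∣ (n ∸ nblocks σ) Z.⊖ k ∣
    ≡⟨ cong ∣_∣ (ZP.⊖-≥ (subst (k ≤ℕ_) (sym (n∸nblocks σ∈)) (NP.m≤n+m k (m ∸ nblocks σ)))) ⟩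
      (n ∸ nblocks σ) ∸ k
    ≡⟨ cong (_∸ k) (n∸nblocks σ∈) ⟩
      (m ∸ nblocks σ) +ℕ k ∸ k
    ≡⟨ NP.m+n∸n≡m (m ∸ nblocks σ) k ⟩
      m ∸ nblocks σ
    ≡⟨ cong (_∸ nblocks σ) (sym (∈-gen⇒length m 0 (proj₁ (rhsIndex⁻ σ∈)))) ⟩
      length σ ∸ nblocks σ
    ∎
    where open ≡-Reasoning

  rhsIndex-range : ∀ {σ} → σ ∈ rhsIndex m n d → + k ≤ d × d ≤ + n
  rhsIndex-range {σ} σ∈ = subst (λ x → + k ≤ x × x ≤ + n) (sym (rhsIndex-d σ∈))
    (Z.+≤+ (subst (k ≤ℕ_) (sym (n∸nblocks σ∈)) (NP.m≤n+m k (m ∸ nblocks σ))) , Z.+≤+ (NP.m∸n≤m n (nblocks σ)))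

  rhsIndex-empty : ¬ (+ k ≤ d × d ≤ + n) → rhsIndex m n d ≡ []
  rhsIndex-empty out = filter-none-∈ _ (P m) (λ σ σ∈P → dec-false (+ nblocks σ Z.≟ (+ n - d))
    (λ blocks≡ → out (rhsIndex-range (MP.∈-filter⁺ (λ Λ → + nblocks Λ Z.≟ (+ n - d)) σ∈P blocks≡))))

  μ₀-rhsIndex : ∀ {σ} → σ ∈ rhsIndex m n d → μ₀ σ ≡ sign ∣ d - + k ∣ * blockWeight σ
  μ₀-rhsIndex {σ} σ∈ = cong (λ e → sign e * blockWeight σ) (sym (rhsIndex-exponent σ∈))

sign-square : ∀ e → sign e * sign e ≡ + 1
sign-square zero = refl
sign-square (suc e) = trans (square (sign e)) (sign-square e)
  where
  square : ∀ s → (- + 1) * s * ((- + 1) * s) ≡ s * s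
  square = solve-∀

productℤ-map-pos : ∀ xs → productℤ (map +_ xs) ≡ + product xs
productℤ-map-pos [] = refl
productℤ-map-pos (x ∷ xs) = trans (cong (+ x *_) (productℤ-map-pos xs)) (sym (ZP.pos-* x (product xs)))

blockWeight-positive : ∀ x → + 0 < blockWeight x
blockWeight-positive x = subst (+ 0 <_) (sym blockWeight≡)
  (Z.+<+ (N.>-nonZero⁻¹ (product factorials) {{product≢0 (AllP.map⁺ {xs = blockSizes x} (tabulate λ {s} _ → (s ∸ 1) !≢0))}}))
  where
  factorials : List ℕ
  factorials = map (λ s → (s ∸ 1) !) (blockSizes x)
  blockWeight≡ : blockWeight x ≡ + product factorials
  blockWeight≡ = trans (cong productℤ (LP.map-∘ (blockSizes x))) (productℤ-map-pos factorials)

module _ (k : ℕ) (λ′ : List ℕ) (d : ℤ) (pos : All (0 <ℕ_) λ′) (m+k≡n : length λ′ +ℕ k ≡ sum λ′) where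

  private
    R : List (List ℕ)
    R = rhsIndex (length λ′) (sum λ′) d

    S : ℤ
    S = sign ∣ d - + k ∣

  μ-Π-rhsIndex : ∀ {σ} → σ ∈ R → μ (sum λ′) (Π λ′) (expand λ′ σ) ≡ S * blockWeight σ
  μ-Π-rhsIndex σ∈ = trans (μ-Π-expand λ′ pos _ (proj₁ (rhsIndex⁻ (length λ′) k (sum λ′) d m+k≡n σ∈)))
                          (μ₀-rhsIndex (length λ′) k (sum λ′) d m+k≡n σ∈)

  sumℤ-lhsIndex : sumℤ (map (μ (sum λ′) (Π λ′)) (lhsIndex (sum λ′) λ′ d)) ≡ S * sumℤ (map blockWeight R)
  sumℤ-lhsIndex = begin
      sumℤ (map (μ (sum λ′) (Π λ′)) (lhsIndex (sum λ′) λ′ d))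
    ≡⟨ cong (sumℤ ∘ map (μ (sum λ′) (Π λ′))) (lhsIndex≡map-expand λ′ pos d) ⟩
      sumℤ (map (μ (sum λ′) (Π λ′)) (map (expand λ′) R))
    ≡⟨ cong sumℤ (sym (LP.map-∘ R)) ⟩
      sumℤ (map (μ (sum λ′) (Π λ′) ∘ expand λ′) R)
    ≡⟨ sumℤ-cong-∈ _ _ R (λ σ σ∈ → μ-Π-rhsIndex σ∈) ⟩
      sumℤ (map (λ σ → S * blockWeight σ) R)
    ≡⟨ sumℤ-scale S blockWeight R ⟩
      S * sumℤ (map blockWeight R)
    ∎
    where open ≡-Reasoning

  lhsIndex-signs : All (λ Λ → + 0 < S * μ (sum λ′) (Π λ′) Λ) (lhsIndex (sum λ′) λ′ d)
  lhsIndex-signs = subst (All (λ Λ → + 0 < S * μ (sum λ′) (Π λ′) Λ)) (sym (lhsIndex≡map-expand λ′ pos d))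
    (AllP.map⁺ (tabulate λ {σ} σ∈ → subst (+ 0 <_) (sym (signed σ∈)) (blockWeight-positive σ)))
    where
    signed : ∀ {σ} → σ ∈ R → S * μ (sum λ′) (Π λ′) (expand λ′ σ) ≡ blockWeight σ
    signed {σ} σ∈ = begin
        S * μ (sum λ′) (Π λ′) (expand λ′ σ)
      ≡⟨ cong (S *_) (μ-Π-rhsIndex σ∈) ⟩
        S * (S * blockWeight σ)
      ≡⟨ sym (ZP.*-assoc S S (blockWeight σ)) ⟩
        S * S * blockWeight σ
      ≡⟨ cong (_* blockWeight σ) (sign-square ∣ d - + k ∣) ⟩
        + 1 * blockWeight σ
      ≡⟨ ZP.*-identityˡ (blockWeight σ) ⟩
        blockWeight σ
      ∎
      where open ≡-Reasoning

  lhsIndex-empty : ¬ (+ k ≤ d × d ≤ + sum λ′) → lhsIndex (sum λ′) λ′ d ≡ []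
  lhsIndex-empty out = trans (lhsIndex≡map-expand λ′ pos d)
    (cong (map (expand λ′)) (rhsIndex-empty (length λ′) k (sum λ′) d m+k≡n out))

lemma3p2 : (n k : ℕ) (λ' : List ℕ) (d : ℤ) →
    All (0 <ℕ_) λ' → Linked _≥ℕ_ λ' → sum λ' ≡ n →
    length λ' +ℕ k ≡ n →
      (sumℤ (map (μ n (Π λ')) (lhsIndex n λ' d))
         ≡ ((- + 1) ^ ∣ d - + k ∣) * sumℤ (map blockWeight (rhsIndex (n ∸ k) n d)))
      × All (λ Λ → + 0 < ((- + 1) ^ ∣ d - + k ∣) * μ n (Π λ') Λ) (lhsIndex n λ' d)
      × (¬ (+ k ≤ d × d ≤ + n) → (lhsIndex n λ' d ≡ []) × (rhsIndex (n ∸ k) n d ≡ []))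
lemma3p2 .(sum λ′) k λ′ d pos _ refl m+k≡n
  rewrite trans (cong (_∸ k) (sym m+k≡n)) (NP.m+n∸n≡m (length λ′) k) =
  sumℤ-lhsIndex k λ′ d pos m+k≡n ,
  lhsIndex-signs k λ′ d pos m+k≡n ,
  λ out → lhsIndex-empty k λ′ d pos m+k≡n out , rhsIndex-empty (length λ′) k (sum λ′) d m+k≡n out
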